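{- Let $n\geqslant1$, $t\geqslant1$, $k\ge1$, let $a_0,a_t$ be elements of a commutative ring with unity, and let $d=\gcd(n,t)$. Then \[ \operatorname{per}\bigl((a_0I_n+a_tP_n^t)\otimes J_k\bigr)=\Bigl[(k!)^{n/d}\sum_{l=0}^k\binom kl^{n/d}\bigl(a_0^{k-l}a_t^l\bigr)^{n/d}\Bigr]^d. \]
   Context: $P_n=(c_{i,j})_{1\le i,j\le n}$ with $c_{i,j}=1$ if $j-i\equiv1\pmod n$ and $0$ otherwise; $P_n^t$ is its $t$-th power. $J_k$ is the $k\times k$ all-ones matrix, $\otimes$ the Kronecker product, $\operatorname{per}$ the permanent. -}

module Defs where

open import Level using (Level)
open import Algebra.Bundles using (CommutativeRing)
open import Data.Nat as ℕ using (ℕ; zero; suc; NonZero; _>_; >-nonZero)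
open import Data.Nat.GCD using (gcd)
open import Data.Nat.GCD using (gcd[m,n]≢0)
open import Data.Nat.DivMod using (_/_)
open import Data.Nat.Divisibility using () renaming (_∣?_ to _ℕ∣?_)
open import Data.Integer as ℤ using (ℤ)
open import Data.Fin using (toℕ)
open import Data.Sum using (inj₁)
open import Data.Bool using (if_then_else_)
open import Data.Bool using (Bool; true; false; _∧_; _∨_; not)
open import Data.Fin using (Fin; zero; suc; remQuot; _≟_)
open import Data.Fin.Properties using ()
open import Data.Product using (proj₁; proj₂)
open import Data.List using (List; []; _∷_; [_]; map; concatMap; allFin; filterᵇ; foldr)
open import Data.Bool.ListAction using (and)
open import Data.Nat.Properties using (>⇒≢)
open import Relation.Nullary.Decidable using (⌊_⌋)

allFuns : (m n : ℕ) → List (Fin m → Fin n)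
allFuns zero    n = [ (λ ()) ]
allFuns (suc m) n = concatMap (λ f → map (λ x → cons x f) (allFin n)) (allFuns m n)
  where
  cons : Fin n → (Fin m → Fin n) → Fin (suc m) → Fin n
  cons x f zero    = x
  cons x f (suc i) = f i

isInjᵇ : {m : ℕ} → (Fin m → Fin m) → Bool
isInjᵇ {m} σ = and (concatMap (λ i → map (λ j → not ⌊ σ i ≟ σ j ⌋ ∨ ⌊ i ≟ j ⌋) (allFin m)) (allFin m))

perms : (m : ℕ) → List (Fin m → Fin m)
perms m = filterᵇ isInjᵇ (allFuns m m)

module RingDefs {c ℓ : Level} (R : CommutativeRing c ℓ) where
  open CommutativeRing R

  Mat : ℕ → Set c
  Mat m = Fin m → Fin m → Carrier

  ∑ : {m : ℕ} → (Fin m → Carrier) → Carrier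
  ∑ {m} f = foldr (λ i acc → f i + acc) 0# (allFin m)

  ∏ : {m : ℕ} → (Fin m → Carrier) → Carrier
  ∏ {m} f = foldr (λ i acc → f i * acc) 1# (allFin m)

  pow : Carrier → ℕ → Carrier
  pow x zero    = 1#
  pow x (suc e) = x * pow x e

  fromℕ : ℕ → Carrier
  fromℕ zero    = 0#
  fromℕ (suc n) = 1# + fromℕ n

  per : {m : ℕ} → Mat m → Carrier
  per {m} A = foldr (λ σ acc → ∏ (λ i → A i (σ i)) + acc) 0# (perms m)

  _⊕_ : {m : ℕ} → Mat m → Mat m → Mat m
  (A ⊕ B) i j = A i j + B i j

  _·_ : {m : ℕ} → Carrier → Mat m → Mat m
  (a · A) i j = a * A i j

  𝟙 : {m : ℕ} → Mat m
  𝟙 i j = if ⌊ i ≟ j ⌋ then 1# else 0#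

  _⊙_ : {m : ℕ} → Mat m → Mat m → Mat m
  (A ⊙ B) i j = ∑ (λ l → A i l * B l j)

  matPow : {m : ℕ} → Mat m → ℕ → Mat m
  matPow A zero    = 𝟙
  matPow A (suc t) = A ⊙ matPow A t

  -- the cyclic permutation matrix P_n: entry 1 iff j - i ≡ 1 (mod n)
  P : (n : ℕ) → Mat n
  P n i j = if ⌊ n ℕ∣? ℤ.∣ (ℤ.+ toℕ j ℤ.- ℤ.+ toℕ i) ℤ.- ℤ.1ℤ ∣ ⌋ then 1# else 0#

  J : (k : ℕ) → Mat k
  J k i j = 1#

  -- Kronecker product A ⊗ B; row/column index of Fin (n * k) decomposed
  -- as (block index, index within block) via remQuot
  _⊗_ : {n k : ℕ} → Mat n → Mat k → Mat (n ℕ.* k)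
  _⊗_ {n} {k} A B r s =
    A (proj₁ (remQuot {n} k r)) (proj₁ (remQuot {n} k s)) *
    B (proj₂ (remQuot {n} k r)) (proj₂ (remQuot {n} k s))

gcd-nonZero : (n t : ℕ) → n > 0 → NonZero (gcd n t)
gcd-nonZero n t n>0 = ℕ.≢-nonZero (gcd[m,n]≢0 n t (inj₁ (>⇒≢ n>0)))

quot-gcd : (n t : ℕ) → n > 0 → ℕ
quot-gcd n t n>0 = _/_ n (gcd n t) {{gcd-nonZero n t n>0}}

module Submission where

-- Write N = n·k and index rows and columns of M = (a₀ I + aₜ Pᵗ) ⊗ J_k by
-- pairs (block i : Fin n, slot c : Fin k).  Then M r s = Σ_{e ∈ {0,1}} wₑ·[blk s = πᵉ (blk r)],
-- with w₀ = a₀, w₁ = aₜ and π the cyclic shift by t on Fin n.  The proof runs: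
--  (1) per M is the sum over injective σ : Fin N → Fin N of ∏_r M r (σ r).
--  (2) Expanding the product over the choices S : Fin N → {0,1} and exchanging sums,
--      per M = Σ_S wt S · #{injective σ with blk (σ r) = π^{S r} (blk r) for all r}.
--  (3) With c_j the number of rows sent to block j, that number is ∏_j k(k-1)⋯(k-c_j+1);
--      since Σ_j c_j = nk it is (k!)ⁿ if every c_j = k and 0 otherwise.  As
--      c_j = (k - u_j) + u_{π⁻¹ j}, where u_i counts the choices 1 in block i, the
--      condition says exactly that u : Fin n → {0..k} is invariant under π.
--  (4) Grouping the S by their block counts u introduces binomial coefficients:
--      per M = (k!)ⁿ · Σ_{u ∘ π = u} ∏_i C(k,u_i) a₀^{k-u_i} aₜ^{u_i}.
--  (5) The orbits of π are the d = gcd(n,t) residue classes mod d, each of size n/d,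
--      so this invariant sum factors as (Σ_l g(l)^{n/d})^d, which is the claim.

open import Defs
open import Level using (Level)
open import Algebra.Bundles using (CommutativeRing)
open import Data.Nat using (ℕ; suc; _≤_; _∸_; _!; _^_; s≤s; z≤n)
open import Data.Nat.GCD using (gcd)
open import Data.Nat.Combinatorics using (_C_)
open import Data.Fin using (toℕ)

module BooleanTests where

  open import Data.Nat using (ℕ; zero; suc)
  open import Data.Fin using (Fin; zero; suc; _≟_)
  open import Data.List using (List; []; _∷_; concatMap; tabulate; _++_)
  open import Data.List.Properties using (map-tabulate)
  open import Data.Fin.Properties using (0≢1+n; suc-injective)
  open import Data.Bool using (Bool; true; false; _∧_; _∨_; not)
  open import Data.Bool.Properties using (∧-conicalˡ; ∧-conicalʳ)
  open import Data.Bool.ListAction using (and)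
  open import Function using (_∘_; id)
  open import Relation.Binary.PropositionalEquality
  open import Relation.Nullary using (Dec; yes; no; ¬_)
  open import Relation.Nullary.Decidable using (⌊_⌋)
  open import Data.Empty using (⊥-elim)

  ⌊⌋-true : {A : Set} (a? : Dec A) → A → ⌊ a? ⌋ ≡ true
  ⌊⌋-true (yes _) _ = refl
  ⌊⌋-true (no ¬a) a = ⊥-elim (¬a a)

  ⌊⌋-false : {A : Set} (a? : Dec A) → ¬ A → ⌊ a? ⌋ ≡ false
  ⌊⌋-false (yes a) ¬a = ⊥-elim (¬a a)
  ⌊⌋-false (no _) _ = refl

  ⌊⌋-sound : {A : Set} (a? : Dec A) → ⌊ a? ⌋ ≡ true → A
  ⌊⌋-sound (yes a) _ = a

  ⌊⌋-cong : {A B : Set} (a? : Dec A) (b? : Dec B) → (A → B) → (B → A) → ⌊ a? ⌋ ≡ ⌊ b? ⌋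
  ⌊⌋-cong (yes _) (yes _) _ _ = refl
  ⌊⌋-cong (no _) (no _) _ _ = refl
  ⌊⌋-cong (yes a) (no ¬b) f _ = ⊥-elim (¬b (f a))
  ⌊⌋-cong (no ¬a) (yes b) _ g = ⊥-elim (¬a (g b))

  bool-iff : ∀ {a b : Bool} → (a ≡ true → b ≡ true) → (b ≡ true → a ≡ true) → a ≡ b
  bool-iff {true} {true} _ _ = refl
  bool-iff {false} {false} _ _ = refl
  bool-iff {true} {false} f _ = sym (f refl)
  bool-iff {false} {true} _ g = g refl

  allᵇ : (n : ℕ) → (Fin n → Bool) → Bool
  allᵇ zero b = true
  allᵇ (suc n) b = b zero ∧ allᵇ n (b ∘ suc)

  allᵇ-elim : ∀ n (b : Fin n → Bool) → allᵇ n b ≡ true → ∀ j → b j ≡ true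
  allᵇ-elim (suc n) b e zero = ∧-conicalˡ _ _ e
  allᵇ-elim (suc n) b e (suc j) = allᵇ-elim n (b ∘ suc) (∧-conicalʳ _ _ e) j

  allᵇ-intro : ∀ n (b : Fin n → Bool) → (∀ j → b j ≡ true) → allᵇ n b ≡ true
  allᵇ-intro zero b h = refl
  allᵇ-intro (suc n) b h rewrite h zero = allᵇ-intro n (b ∘ suc) (h ∘ suc)

  allᵇ-cong : ∀ n {b b' : Fin n → Bool} → (∀ j → b j ≡ b' j) → allᵇ n b ≡ allᵇ n b'
  allᵇ-cong zero e = refl
  allᵇ-cong (suc n) e = cong₂ _∧_ (e zero) (allᵇ-cong n (e ∘ suc))

  eqᵇ : {m K : ℕ} → (Fin m → Fin K) → (Fin m → Fin K) → Bool
  eqᵇ {zero} z h = true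
  eqᵇ {suc m} z h = ⌊ z zero ≟ h zero ⌋ ∧ eqᵇ (z ∘ suc) (h ∘ suc)

  eqᵇ-sound : ∀ {m K} (z h : Fin m → Fin K) → eqᵇ z h ≡ true → ∀ i → z i ≡ h i
  eqᵇ-sound z h e zero = ⌊⌋-sound (z zero ≟ h zero) (∧-conicalˡ _ _ e)
  eqᵇ-sound z h e (suc i) = eqᵇ-sound (z ∘ suc) (h ∘ suc) (∧-conicalʳ _ _ e) i

  eqᵇ-complete : ∀ {m K} (z h : Fin m → Fin K) → (∀ i → z i ≡ h i) → eqᵇ z h ≡ true
  eqᵇ-complete {zero} z h a = refl
  eqᵇ-complete {suc m} z h a rewrite ⌊⌋-true (z zero ≟ h zero) (a zero) = eqᵇ-complete (z ∘ suc) (h ∘ suc) (a ∘ suc)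

  eqᵇ-cong : ∀ {m K} {z z' h h' : Fin m → Fin K} → (∀ i → z i ≡ z' i) → (∀ i → h i ≡ h' i) → eqᵇ z h ≡ eqᵇ z' h'
  eqᵇ-cong {z = z} {z'} {h} {h'} ez eh = bool-iff
    (λ p → eqᵇ-complete z' h' (λ i → trans (sym (ez i)) (trans (eqᵇ-sound z h p i) (eh i))))
    (λ p → eqᵇ-complete z h (λ i → trans (ez i) (trans (eqᵇ-sound z' h' p i) (sym (eh i)))))

  avoidsᵇ : {m M : ℕ} → Fin M → (Fin m → Fin M) → Bool
  avoidsᵇ {zero} x g = true
  avoidsᵇ {suc m} x g = not ⌊ g zero ≟ x ⌋ ∧ avoidsᵇ x (g ∘ suc)

  injectiveᵇ : {m M : ℕ} → (Fin m → Fin M) → Bool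
  injectiveᵇ {zero} f = true
  injectiveᵇ {suc m} f = avoidsᵇ (f zero) (f ∘ suc) ∧ injectiveᵇ (f ∘ suc)

  avoidsᵇ-cong : {m M : ℕ} (x : Fin M) {f g : Fin m → Fin M} → (∀ i → f i ≡ g i) → avoidsᵇ x f ≡ avoidsᵇ x g
  avoidsᵇ-cong {zero} x e = refl
  avoidsᵇ-cong {suc m} x {f} {g} e rewrite e zero = cong (not ⌊ g zero ≟ x ⌋ ∧_) (avoidsᵇ-cong x (e ∘ suc))

  injectiveᵇ-cong : {m M : ℕ} {f g : Fin m → Fin M} → (∀ i → f i ≡ g i) → injectiveᵇ f ≡ injectiveᵇ g
  injectiveᵇ-cong {zero} e = refl
  injectiveᵇ-cong {suc m} {f = f} {g} e rewrite e zero =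
    cong₂ _∧_ (avoidsᵇ-cong (g zero) (e ∘ suc)) (injectiveᵇ-cong (e ∘ suc))

  Injective : {m M : ℕ} → (Fin m → Fin M) → Set
  Injective f = ∀ i j → f i ≡ f j → i ≡ j

  avoidsᵇ-sound : ∀ {m M} (x : Fin M) (g : Fin m → Fin M) → avoidsᵇ x g ≡ true → ∀ i → ¬ g i ≡ x
  avoidsᵇ-sound x g e zero p rewrite ⌊⌋-true (g zero ≟ x) p with () ← e
  avoidsᵇ-sound x g e (suc i) = avoidsᵇ-sound x (g ∘ suc) (∧-conicalʳ _ _ e) i

  avoidsᵇ-complete : ∀ {m M} (x : Fin M) (g : Fin m → Fin M) → (∀ i → ¬ g i ≡ x) → avoidsᵇ x g ≡ true
  avoidsᵇ-complete {zero} x g h = refl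
  avoidsᵇ-complete {suc m} x g h rewrite ⌊⌋-false (g zero ≟ x) (h zero) = avoidsᵇ-complete x (g ∘ suc) (h ∘ suc)

  injectiveᵇ-sound : ∀ {m M} (f : Fin m → Fin M) → injectiveᵇ f ≡ true → Injective f
  injectiveᵇ-sound f e zero zero p = refl
  injectiveᵇ-sound f e zero (suc j) p = ⊥-elim (avoidsᵇ-sound (f zero) (f ∘ suc) (∧-conicalˡ _ _ e) j (sym p))
  injectiveᵇ-sound f e (suc i) zero p = ⊥-elim (avoidsᵇ-sound (f zero) (f ∘ suc) (∧-conicalˡ _ _ e) i p)
  injectiveᵇ-sound f e (suc i) (suc j) p = cong suc (injectiveᵇ-sound (f ∘ suc) (∧-conicalʳ _ _ e) i j p)

  injectiveᵇ-complete : ∀ {m M} (f : Fin m → Fin M) → Injective f → injectiveᵇ f ≡ true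
  injectiveᵇ-complete {zero} f h = refl
  injectiveᵇ-complete {suc m} f h
    rewrite avoidsᵇ-complete (f zero) (f ∘ suc) (λ i p → 0≢1+n (sym (h (suc i) zero p))) =
    injectiveᵇ-complete (f ∘ suc) (λ i j p → suc-injective (h (suc i) (suc j) p))

  and-++ : (xs ys : List Bool) → and (xs ++ ys) ≡ and xs ∧ and ys
  and-++ [] ys = refl
  and-++ (true ∷ xs) ys = and-++ xs ys
  and-++ (false ∷ xs) ys = refl

  and-concatMap : {A : Set} → ∀ m (g : Fin m → A) (h : A → List Bool) →
    and (concatMap h (tabulate g)) ≡ allᵇ m (λ i → and (h (g i)))
  and-concatMap zero g h = refl
  and-concatMap (suc m) g h = trans (and-++ (h (g zero)) _) (cong (and (h (g zero)) ∧_) (and-concatMap m (g ∘ suc) h))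

  and-tabulate : ∀ m (f : Fin m → Bool) → and (tabulate f) ≡ allᵇ m f
  and-tabulate zero f = refl
  and-tabulate (suc m) f = cong (f zero ∧_) (and-tabulate m (f ∘ suc))

  isInjᵇ-pairs : ∀ {m} (σ : Fin m → Fin m) →
    isInjᵇ σ ≡ allᵇ m (λ i → allᵇ m (λ j → not ⌊ σ i ≟ σ j ⌋ ∨ ⌊ i ≟ j ⌋))
  isInjᵇ-pairs {m} σ = trans (and-concatMap m id _)
    (allᵇ-cong m (λ i → trans (cong and (map-tabulate id (λ j → not ⌊ σ i ≟ σ j ⌋ ∨ ⌊ i ≟ j ⌋))) (and-tabulate m _)))

  isInjᵇ-sound : ∀ {m} (σ : Fin m → Fin m) → isInjᵇ σ ≡ true → Injective σ
  isInjᵇ-sound {m} σ e i j p with allᵇ-elim m _ (allᵇ-elim m _ (trans (sym (isInjᵇ-pairs σ)) e) i) j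
  ... | pair-ok rewrite ⌊⌋-true (σ i ≟ σ j) p = ⌊⌋-sound (i ≟ j) pair-ok

  isInjᵇ-complete : ∀ {m} (σ : Fin m → Fin m) → Injective σ → isInjᵇ σ ≡ true
  isInjᵇ-complete {m} σ h = trans (isInjᵇ-pairs σ) (allᵇ-intro m _ (λ i → allᵇ-intro m _ (λ j → pair-ok i j)))
    where
    pair-ok : ∀ i j → (not ⌊ σ i ≟ σ j ⌋ ∨ ⌊ i ≟ j ⌋) ≡ true
    pair-ok i j with σ i ≟ σ j
    ... | no _ = refl
    ... | yes p rewrite ⌊⌋-true (i ≟ j) (h i j p) = refl

  isInjᵇ≡injectiveᵇ : ∀ {m} (σ : Fin m → Fin m) → isInjᵇ σ ≡ injectiveᵇ σ
  isInjᵇ≡injectiveᵇ σ = bool-iff (λ e → injectiveᵇ-complete σ (isInjᵇ-sound σ e))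
                                 (λ e → isInjᵇ-complete σ (injectiveᵇ-sound σ e))

module BigOperators where

  open import Algebra.Bundles using (CommutativeSemiring)
  open import Data.Nat as ℕ using (ℕ; zero; suc)
  open import Data.Fin using (Fin; zero; suc; _↑ˡ_; _↑ʳ_; combine; _≟_; splitAt)
  open import Data.Sum using (inj₁; inj₂; [_,_]′)
  open import Data.List using (List; []; _∷_; map; concatMap; allFin; filterᵇ; foldr; tabulate; _++_)
  open import Data.Bool using (Bool; true; false; if_then_else_; _∧_)
  open import Function using (_∘_)
  open import Relation.Binary.PropositionalEquality as P using (_≡_)
  open import Relation.Nullary.Decidable using (⌊_⌋)
  open import Relation.Nullary using (yes; no)
  open BooleanTests using (eqᵇ; eqᵇ-cong)

  module Sums {c ℓ : Level} (S : CommutativeSemiring c ℓ) where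
    open CommutativeSemiring S hiding (zero)
    open import Relation.Binary.Reasoning.Setoid setoid

    Σl : {A : Set} → List A → (A → Carrier) → Carrier
    Σl xs f = foldr (λ x acc → f x + acc) 0# xs

    Πl : {A : Set} → List A → (A → Carrier) → Carrier
    Πl xs f = foldr (λ x acc → f x * acc) 1# xs

    ΣF : (m : ℕ) → (Fin m → Carrier) → Carrier
    ΣF m f = Σl (allFin m) f

    ΠF : (m : ℕ) → (Fin m → Carrier) → Carrier
    ΠF m f = Πl (allFin m) f

    Σl-cong : {A : Set} (xs : List A) {f g : A → Carrier} → (∀ x → f x ≈ g x) → Σl xs f ≈ Σl xs g
    Σl-cong [] e = refl
    Σl-cong (x ∷ xs) e = +-cong (e x) (Σl-cong xs e)

    Πl-cong : {A : Set} (xs : List A) {f g : A → Carrier} → (∀ x → f x ≈ g x) → Πl xs f ≈ Πl xs g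
    Πl-cong [] e = refl
    Πl-cong (x ∷ xs) e = *-cong (e x) (Πl-cong xs e)

    ΣF-cong : (m : ℕ) {f g : Fin m → Carrier} → (∀ x → f x ≈ g x) → ΣF m f ≈ ΣF m g
    ΣF-cong m = Σl-cong (allFin m)

    ΠF-cong : (m : ℕ) {f g : Fin m → Carrier} → (∀ x → f x ≈ g x) → ΠF m f ≈ ΠF m g
    ΠF-cong m = Πl-cong (allFin m)

    Σl-map : {A B : Set} (h : A → B) (xs : List A) (f : B → Carrier) → Σl (map h xs) f ≡ Σl xs (f ∘ h)
    Σl-map h [] f = P.refl
    Σl-map h (x ∷ xs) f = P.cong (f (h x) +_) (Σl-map h xs f)

    -- allFin is a tabulation, so summing over it peels off the index zero.
    Σl-tabulate : {A : Set} (m : ℕ) (h : Fin m → A) (f : A → Carrier) → Σl (tabulate h) f ≡ ΣF m (f ∘ h)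
    Σl-tabulate zero h f = P.refl
    Σl-tabulate (suc m) h f =
      P.cong (f (h zero) +_) (P.trans (Σl-tabulate m (h ∘ suc) f) (P.sym (Σl-tabulate m suc (f ∘ h))))

    Πl-tabulate : {A : Set} (m : ℕ) (h : Fin m → A) (f : A → Carrier) → Πl (tabulate h) f ≡ ΠF m (f ∘ h)
    Πl-tabulate zero h f = P.refl
    Πl-tabulate (suc m) h f =
      P.cong (f (h zero) *_) (P.trans (Πl-tabulate m (h ∘ suc) f) (P.sym (Πl-tabulate m suc (f ∘ h))))

    ΣF-suc : (m : ℕ) (f : Fin (suc m) → Carrier) → ΣF (suc m) f ≡ f zero + ΣF m (f ∘ suc)
    ΣF-suc m f = P.cong (f zero +_) (Σl-tabulate m suc f)

    ΠF-suc : (m : ℕ) (f : Fin (suc m) → Carrier) → ΠF (suc m) f ≡ f zero * ΠF m (f ∘ suc)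
    ΠF-suc m f = P.cong (f zero *_) (Πl-tabulate m suc f)

    Σl-++ : {A : Set} (xs ys : List A) (f : A → Carrier) → Σl (xs ++ ys) f ≈ Σl xs f + Σl ys f
    Σl-++ [] ys f = sym (+-identityˡ _)
    Σl-++ (x ∷ xs) ys f = trans (+-congˡ (Σl-++ xs ys f)) (sym (+-assoc _ _ _))

    Σl-concatMap : {A B : Set} (h : A → List B) (xs : List A) (f : B → Carrier) →
      Σl (concatMap h xs) f ≈ Σl xs (λ x → Σl (h x) f)
    Σl-concatMap h [] f = refl
    Σl-concatMap h (x ∷ xs) f = trans (Σl-++ (h x) _ f) (+-congˡ (Σl-concatMap h xs f))

    Σl-filter : {A : Set} (p : A → Bool) (xs : List A) (f : A → Carrier) →
      Σl (filterᵇ p xs) f ≈ Σl xs (λ x → if p x then f x else 0#)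
    Σl-filter p [] f = refl
    Σl-filter p (x ∷ xs) f with p x
    ... | true = +-congˡ (Σl-filter p xs f)
    ... | false = trans (Σl-filter p xs f) (sym (+-identityˡ _))

    Σl-0 : {A : Set} (xs : List A) → Σl xs (λ _ → 0#) ≈ 0#
    Σl-0 [] = refl
    Σl-0 (x ∷ xs) = trans (+-identityˡ _) (Σl-0 xs)

    Πl-1 : {A : Set} (xs : List A) → Πl xs (λ _ → 1#) ≈ 1#
    Πl-1 [] = refl
    Πl-1 (x ∷ xs) = trans (*-identityˡ _) (Πl-1 xs)

    open import Algebra.Properties.CommutativeSemigroup +-commutativeSemigroup using ()
      renaming (interchange to +-interchange)
    open import Algebra.Properties.CommutativeSemigroup *-commutativeSemigroup using (x∙yz≈y∙xz)
      renaming (interchange to *-interchange)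

    Σl-+ : {A : Set} (xs : List A) (f g : A → Carrier) → Σl xs (λ x → f x + g x) ≈ Σl xs f + Σl xs g
    Σl-+ [] f g = sym (+-identityˡ _)
    Σl-+ (x ∷ xs) f g = trans (+-congˡ (Σl-+ xs f g)) (+-interchange _ _ _ _)

    Πl-* : {A : Set} (xs : List A) (f g : A → Carrier) → Πl xs (λ x → f x * g x) ≈ Πl xs f * Πl xs g
    Πl-* [] f g = sym (*-identityˡ _)
    Πl-* (x ∷ xs) f g = trans (*-congˡ (Πl-* xs f g)) (*-interchange _ _ _ _)

    Σl-*ˡ : {A : Set} (xs : List A) (a : Carrier) (f : A → Carrier) → a * Σl xs f ≈ Σl xs (λ x → a * f x)
    Σl-*ˡ [] a f = zeroʳ a
    Σl-*ˡ (x ∷ xs) a f = trans (distribˡ _ _ _) (+-congˡ (Σl-*ˡ xs a f))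

    Σl-*ʳ : {A : Set} (xs : List A) (a : Carrier) (f : A → Carrier) → Σl xs f * a ≈ Σl xs (λ x → f x * a)
    Σl-*ʳ xs a f = trans (*-comm _ _) (trans (Σl-*ˡ xs a f) (Σl-cong xs (λ x → *-comm _ _)))

    Σl-swap : {A B : Set} (xs : List A) (ys : List B) (f : A → B → Carrier) →
      Σl xs (λ x → Σl ys (λ y → f x y)) ≈ Σl ys (λ y → Σl xs (λ x → f x y))
    Σl-swap [] ys f = sym (Σl-0 ys)
    Σl-swap (x ∷ xs) ys f = trans (+-congˡ (Σl-swap xs ys f)) (sym (Σl-+ ys _ _))

    ΣF-+ : (a b : ℕ) (f : Fin (a ℕ.+ b) → Carrier) →
      ΣF (a ℕ.+ b) f ≈ ΣF a (λ i → f (i ↑ˡ b)) + ΣF b (λ j → f (a ↑ʳ j))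
    ΣF-+ zero b f = sym (+-identityˡ _)
    ΣF-+ (suc a) b f = begin
      ΣF (suc a ℕ.+ b) f                                                ≡⟨ ΣF-suc (a ℕ.+ b) f ⟩
      f zero + ΣF (a ℕ.+ b) (f ∘ suc)                                   ≈⟨ +-congˡ (ΣF-+ a b (f ∘ suc)) ⟩
      f zero + (ΣF a (λ i → f (suc (i ↑ˡ b))) + ΣF b (λ j → f (suc a ↑ʳ j))) ≈⟨ sym (+-assoc _ _ _) ⟩
      f zero + ΣF a (λ i → f (suc (i ↑ˡ b))) + ΣF b (λ j → f (suc a ↑ʳ j))
        ≡⟨ P.cong (_+ ΣF b (λ j → f (suc a ↑ʳ j))) (P.sym (ΣF-suc a (λ i → f (i ↑ˡ b)))) ⟩
      ΣF (suc a) (λ i → f (i ↑ˡ b)) + ΣF b (λ j → f (suc a ↑ʳ j)) ∎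

    ΠF-+ : (a b : ℕ) (f : Fin (a ℕ.+ b) → Carrier) →
      ΠF (a ℕ.+ b) f ≈ ΠF a (λ i → f (i ↑ˡ b)) * ΠF b (λ j → f (a ↑ʳ j))
    ΠF-+ zero b f = sym (*-identityˡ _)
    ΠF-+ (suc a) b f = begin
      ΠF (suc a ℕ.+ b) f                                                ≡⟨ ΠF-suc (a ℕ.+ b) f ⟩
      f zero * ΠF (a ℕ.+ b) (f ∘ suc)                                   ≈⟨ *-congˡ (ΠF-+ a b (f ∘ suc)) ⟩
      f zero * (ΠF a (λ i → f (suc (i ↑ˡ b))) * ΠF b (λ j → f (suc a ↑ʳ j))) ≈⟨ sym (*-assoc _ _ _) ⟩
      f zero * ΠF a (λ i → f (suc (i ↑ˡ b))) * ΠF b (λ j → f (suc a ↑ʳ j))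
        ≡⟨ P.cong (_* ΠF b (λ j → f (suc a ↑ʳ j))) (P.sym (ΠF-suc a (λ i → f (i ↑ˡ b)))) ⟩
      ΠF (suc a) (λ i → f (i ↑ˡ b)) * ΠF b (λ j → f (suc a ↑ʳ j)) ∎

    ΣF-combine : (n k : ℕ) (f : Fin (n ℕ.* k) → Carrier) →
      ΣF (n ℕ.* k) f ≈ ΣF n (λ i → ΣF k (λ c → f (combine i c)))
    ΣF-combine zero k f = refl
    ΣF-combine (suc n) k f = begin
      ΣF (k ℕ.+ n ℕ.* k) f                                              ≈⟨ ΣF-+ k (n ℕ.* k) f ⟩
      ΣF k (λ c → f (c ↑ˡ (n ℕ.* k))) + ΣF (n ℕ.* k) (λ j → f (k ↑ʳ j)) ≈⟨ +-congˡ (ΣF-combine n k (λ j → f (k ↑ʳ j))) ⟩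
      ΣF k (λ c → f (c ↑ˡ (n ℕ.* k))) + ΣF n (λ i → ΣF k (λ c → f (k ↑ʳ combine i c)))
        ≡⟨ P.sym (ΣF-suc n (λ i → ΣF k (λ c → f (combine i c)))) ⟩
      ΣF (suc n) (λ i → ΣF k (λ c → f (combine i c))) ∎

    ΠF-combine : (n k : ℕ) (f : Fin (n ℕ.* k) → Carrier) →
      ΠF (n ℕ.* k) f ≈ ΠF n (λ i → ΠF k (λ c → f (combine i c)))
    ΠF-combine zero k f = refl
    ΠF-combine (suc n) k f = begin
      ΠF (k ℕ.+ n ℕ.* k) f                                              ≈⟨ ΠF-+ k (n ℕ.* k) f ⟩
      ΠF k (λ c → f (c ↑ˡ (n ℕ.* k))) * ΠF (n ℕ.* k) (λ j → f (k ↑ʳ j)) ≈⟨ *-congˡ (ΠF-combine n k (λ j → f (k ↑ʳ j))) ⟩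
      ΠF k (λ c → f (c ↑ˡ (n ℕ.* k))) * ΠF n (λ i → ΠF k (λ c → f (k ↑ʳ combine i c)))
        ≡⟨ P.sym (ΠF-suc n (λ i → ΠF k (λ c → f (combine i c)))) ⟩
      ΠF (suc n) (λ i → ΠF k (λ c → f (combine i c))) ∎

    ΣF-δ : (m : ℕ) (j : Fin m) (f : Fin m → Carrier) → ΣF m (λ i → if ⌊ i ≟ j ⌋ then f i else 0#) ≈ f j
    ΣF-δ (suc m) zero f = begin
      ΣF (suc m) (λ i → if ⌊ i ≟ zero ⌋ then f i else 0#) ≡⟨ ΣF-suc m _ ⟩
      f zero + ΣF m (λ i → 0#)                            ≈⟨ +-congˡ (Σl-0 (allFin m)) ⟩
      f zero + 0#                                         ≈⟨ +-identityʳ _ ⟩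
      f zero ∎
    ΣF-δ (suc m) (suc j) f = begin
      ΣF (suc m) (λ i → if ⌊ i ≟ suc j ⌋ then f i else 0#)               ≡⟨ ΣF-suc m _ ⟩
      0# + ΣF m (λ i → if ⌊ suc i ≟ suc j ⌋ then f (suc i) else 0#)      ≈⟨ +-identityˡ _ ⟩
      ΣF m (λ i → if ⌊ suc i ≟ suc j ⌋ then f (suc i) else 0#)           ≈⟨ ΣF-cong m shift ⟩
      ΣF m (λ i → if ⌊ i ≟ j ⌋ then f (suc i) else 0#)                   ≈⟨ ΣF-δ m j (f ∘ suc) ⟩
      f (suc j) ∎
      where
      shift : ∀ i → (if ⌊ suc i ≟ suc j ⌋ then f (suc i) else 0#) ≈ (if ⌊ i ≟ j ⌋ then f (suc i) else 0#)
      shift i with i ≟ j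
      ... | yes _ = refl
      ... | no _ = refl

    ΠF-update : (n : ℕ) (j₀ : Fin n) (a : Carrier) (g : Fin n → Carrier) →
      ΠF n (λ j → if ⌊ j ≟ j₀ ⌋ then a * g j else g j) ≈ a * ΠF n g
    ΠF-update (suc n) zero a g =
      trans (reflexive (ΠF-suc n _)) (trans (*-assoc _ _ _) (*-congˡ (reflexive (P.sym (ΠF-suc n g)))))
    ΠF-update (suc n) (suc j₀) a g = begin
      ΠF (suc n) (λ j → if ⌊ j ≟ suc j₀ ⌋ then a * g j else g j)                     ≡⟨ ΠF-suc n _ ⟩
      g zero * ΠF n (λ j → if ⌊ suc j ≟ suc j₀ ⌋ then a * g (suc j) else g (suc j)) ≈⟨ *-congˡ (ΠF-cong n shift) ⟩
      g zero * ΠF n (λ j → if ⌊ j ≟ j₀ ⌋ then a * g (suc j) else g (suc j))         ≈⟨ *-congˡ (ΠF-update n j₀ a (g ∘ suc)) ⟩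
      g zero * (a * ΠF n (g ∘ suc))                                                 ≈⟨ x∙yz≈y∙xz _ _ _ ⟩
      a * (g zero * ΠF n (g ∘ suc))                                                 ≡⟨ P.cong (a *_) (P.sym (ΠF-suc n g)) ⟩
      a * ΠF (suc n) g ∎
      where
      shift : ∀ j → (if ⌊ suc j ≟ suc j₀ ⌋ then a * g (suc j) else g (suc j)) ≈ (if ⌊ j ≟ j₀ ⌋ then a * g (suc j) else g (suc j))
      shift j with j ≟ j₀
      ... | yes _ = refl
      ... | no _ = refl

    ΣF-split-if : (m : ℕ) (b : Fin m → Bool) (X : Fin m → Carrier) →
      ΣF m (λ x → if b x then X x else 0#) + ΣF m (λ x → if b x then 0# else X x) ≈ ΣF m X
    ΣF-split-if m b X = trans (sym (Σl-+ (allFin m) _ _)) (ΣF-cong m split)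
      where
      split : ∀ x → (if b x then X x else 0#) + (if b x then 0# else X x) ≈ X x
      split x with b x
      ... | true = +-identityʳ _
      ... | false = +-identityˡ _

    -- Sums over all functions Fin m → Fin K.  Summands must respect pointwise
    -- equality of functions (Resp), since the enumeration allFuns builds its
    -- functions by consing.
    Resp : {m K : ℕ} → ((Fin m → Fin K) → Carrier) → Set ℓ
    Resp {m} {K} G = ∀ {f g : Fin m → Fin K} → (∀ i → f i ≡ g i) → G f ≈ G g

    ΣA : (m K : ℕ) → ((Fin m → Fin K) → Carrier) → Carrier
    ΣA m K G = Σl (allFuns m K) G

    ΣA-cong : (m K : ℕ) {G H : (Fin m → Fin K) → Carrier} → (∀ f → G f ≈ H f) → ΣA m K G ≈ ΣA m K H
    ΣA-cong m K = Σl-cong (allFuns m K)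

    cons : {m K : ℕ} → Fin K → (Fin m → Fin K) → Fin (suc m) → Fin K
    cons x f zero = x
    cons x f (suc i) = f i

    ΣA-suc : (m K : ℕ) (G : (Fin (suc m) → Fin K) → Carrier) → Resp G →
      ΣA (suc m) K G ≈ ΣA m K (λ f → ΣF K (λ x → G (cons x f)))
    ΣA-suc m K G r = begin
      ΣA (suc m) K G                                     ≈⟨ Σl-concatMap _ (allFuns m K) G ⟩
      Σl (allFuns m K) (λ f → Σl (map _ (allFin K)) G)
        ≈⟨ ΣA-cong m K (λ f → trans (reflexive (Σl-map _ (allFin K) G))
                                    (ΣF-cong K (λ x → r (λ { zero → P.refl ; (suc i) → P.refl })))) ⟩
      ΣA m K (λ f → ΣF K (λ x → G (cons x f))) ∎

    prod-of-sums : (m K : ℕ) (u : Fin m → Fin K → Carrier) →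
      ΠF m (λ r → ΣF K (u r)) ≈ ΣA m K (λ S → ΠF m (λ r → u r (S r)))
    prod-of-sums zero K u = sym (+-identityʳ _)
    prod-of-sums (suc m) K u = begin
      ΠF (suc m) (λ r → ΣF K (u r))                                    ≡⟨ ΠF-suc m _ ⟩
      ΣF K (u zero) * ΠF m (λ r → ΣF K (u (suc r)))                    ≈⟨ *-congˡ (prod-of-sums m K (u ∘ suc)) ⟩
      ΣF K (u zero) * ΣA m K (λ S → ΠF m (λ r → u (suc r) (S r)))      ≈⟨ Σl-*ˡ (allFuns m K) _ _ ⟩
      ΣA m K (λ S → ΣF K (u zero) * ΠF m (λ r → u (suc r) (S r)))      ≈⟨ ΣA-cong m K (λ S → Σl-*ʳ (allFin K) _ _) ⟩
      ΣA m K (λ S → ΣF K (λ x → u zero x * ΠF m (λ r → u (suc r) (S r))))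
        ≈⟨ ΣA-cong m K (λ S → ΣF-cong K (λ x → reflexive (P.sym (ΠF-suc m _)))) ⟩
      ΣA m K (λ f → ΣF K (λ x → ΠF (suc m) (λ r → u r (cons x f r))))
        ≈⟨ sym (ΣA-suc m K _ (λ e → ΠF-cong (suc m) (λ r → reflexive (P.cong (u r) (e r))))) ⟩
      ΣA (suc m) K (λ S → ΠF (suc m) (λ r → u r (S r))) ∎

    join : {a b K : ℕ} → (Fin a → Fin K) → (Fin b → Fin K) → Fin (a ℕ.+ b) → Fin K
    join {a} w z i = [ w , z ]′ (splitAt a i)

    join-cons : {a b K : ℕ} (x : Fin K) (w : Fin a → Fin K) (z : Fin b → Fin K) (i : Fin (suc a ℕ.+ b)) →
      cons x (join w z) i ≡ join (cons x w) z i
    join-cons x w z zero = P.refl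
    join-cons {a} x w z (suc i) with splitAt a i
    ... | inj₁ _ = P.refl
    ... | inj₂ _ = P.refl

    join-congˡ : {a b K : ℕ} {w w' : Fin a → Fin K} → (∀ i → w i ≡ w' i) → (z : Fin b → Fin K) →
      ∀ i → join w z i ≡ join w' z i
    join-congˡ {a} e z i with splitAt a i
    ... | inj₁ j = e j
    ... | inj₂ j = P.refl

    ΣA-split : (a b K : ℕ) (G : (Fin (a ℕ.+ b) → Fin K) → Carrier) → Resp G →
      ΣA (a ℕ.+ b) K G ≈ ΣA a K (λ w → ΣA b K (λ z → G (join w z)))
    ΣA-split zero b K G r = sym (trans (+-identityʳ _) (ΣA-cong b K (λ z → r (λ i → P.refl))))
    ΣA-split (suc a) b K G r = begin
      ΣA (suc a ℕ.+ b) K G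
        ≈⟨ ΣA-suc (a ℕ.+ b) K G r ⟩
      ΣA (a ℕ.+ b) K (λ f → ΣF K (λ x → G (cons x f)))
        ≈⟨ ΣA-split a b K _ (λ e → ΣF-cong K (λ x → r (λ { zero → P.refl ; (suc i) → e i }))) ⟩
      ΣA a K (λ w → ΣA b K (λ z → ΣF K (λ x → G (cons x (join w z)))))
        ≈⟨ ΣA-cong a K (λ w → Σl-swap (allFuns b K) (allFin K) _) ⟩
      ΣA a K (λ w → ΣF K (λ x → ΣA b K (λ z → G (cons x (join w z)))))
        ≈⟨ ΣA-cong a K (λ w → ΣF-cong K (λ x → ΣA-cong b K (λ z → r (join-cons x w z)))) ⟩
      ΣA a K (λ w → ΣF K (λ x → ΣA b K (λ z → G (join (cons x w) z))))
        ≈⟨ sym (ΣA-suc a K _ (λ e → ΣA-cong b K (λ z → r (join-congˡ e z)))) ⟩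
      ΣA (suc a) K (λ w → ΣA b K (λ z → G (join w z))) ∎

    ΣA-δ : (m K : ℕ) (h : Fin m → Fin K) (G : (Fin m → Fin K) → Carrier) → Resp G →
      ΣA m K (λ z → if eqᵇ z h then G z else 0#) ≈ G h
    ΣA-δ zero K h G r = trans (+-identityʳ _) (r (λ ()))
    ΣA-δ (suc m) K h G r = begin
      ΣA (suc m) K (λ z → if eqᵇ z h then G z else 0#)
        ≈⟨ ΣA-suc m K _ resp ⟩
      ΣA m K (λ f → ΣF K (λ x → if ⌊ x ≟ h zero ⌋ ∧ eqᵇ f (h ∘ suc) then G (cons x f) else 0#))
        ≈⟨ ΣA-cong m K (λ f → ΣF-cong K (λ x → nest (⌊ x ≟ h zero ⌋) _ _)) ⟩
      ΣA m K (λ f → ΣF K (λ x → if ⌊ x ≟ h zero ⌋ then (if eqᵇ f (h ∘ suc) then G (cons x f) else 0#) else 0#))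
        ≈⟨ ΣA-cong m K (λ f → ΣF-δ K (h zero) _) ⟩
      ΣA m K (λ f → if eqᵇ f (h ∘ suc) then G (cons (h zero) f) else 0#)
        ≈⟨ ΣA-δ m K (h ∘ suc) _ (λ e → r (λ { zero → P.refl ; (suc i) → e i })) ⟩
      G (cons (h zero) (h ∘ suc))
        ≈⟨ r (λ { zero → P.refl ; (suc i) → P.refl }) ⟩
      G h ∎
      where
      nest : ∀ a b X → (if a ∧ b then X else 0#) ≈ (if a then (if b then X else 0#) else 0#)
      nest true b X = refl
      nest false b X = refl
      resp : Resp (λ z → if eqᵇ z h then G z else 0#)
      resp {f} {g} e rewrite eqᵇ-cong {h = h} e (λ _ → P.refl) with eqᵇ g h
      ... | true = r e
      ... | false = refl

-- The canonical map fromℕ : ℕ → R and the power function pow of Defs agree with the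
-- library's n × 1# and x ^ n, so their homomorphism laws are taken from the library.
module RingFacts {c ℓ : Level} (R : CommutativeRing c ℓ) where

  open import Data.Nat as ℕ using (ℕ; zero; suc)
  import Data.Nat.Properties as ℕP
  open import Data.Fin using (Fin; zero; suc)
  open import Data.List using (List; []; _∷_; allFin)
  open import Function using (_∘_)
  import Relation.Binary.PropositionalEquality as P
  open P using (_≡_)
  open CommutativeRing R hiding (zero)
  open RingDefs R using (fromℕ; pow)
  import Algebra.Properties.Semiring.Mult semiring as Mult
  import Algebra.Properties.CommutativeSemiring.Exp commutativeSemiring as Exp
  open import Relation.Binary.Reasoning.Setoid setoid

  open BigOperators.Sums commutativeSemiring public
  module ℕΣ = BigOperators.Sums ℕP.+-*-commutativeSemiring

  fromℕ≡×1 : ∀ n → fromℕ n ≡ n Mult.× 1#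
  fromℕ≡×1 zero = P.refl
  fromℕ≡×1 (suc n) = P.cong (1# +_) (fromℕ≡×1 n)

  pow≡^ : ∀ x e → pow x e ≡ x Exp.^ e
  pow≡^ x zero = P.refl
  pow≡^ x (suc e) = P.cong (x *_) (pow≡^ x e)

  fromℕ-1 : fromℕ 1 ≈ 1#
  fromℕ-1 = +-identityʳ _

  fromℕ-+ : ∀ a b → fromℕ (a ℕ.+ b) ≈ fromℕ a + fromℕ b
  fromℕ-+ a b = begin
    fromℕ (a ℕ.+ b)              ≡⟨ fromℕ≡×1 (a ℕ.+ b) ⟩
    (a ℕ.+ b) Mult.× 1#          ≈⟨ Mult.×-homo-+ 1# a b ⟩
    a Mult.× 1# + b Mult.× 1#    ≡⟨ P.sym (P.cong₂ _+_ (fromℕ≡×1 a) (fromℕ≡×1 b)) ⟩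
    fromℕ a + fromℕ b ∎

  fromℕ-* : ∀ a b → fromℕ (a ℕ.* b) ≈ fromℕ a * fromℕ b
  fromℕ-* a b = begin
    fromℕ (a ℕ.* b)               ≡⟨ fromℕ≡×1 (a ℕ.* b) ⟩
    (a ℕ.* b) Mult.× 1#           ≈⟨ Mult.×1-homo-* a b ⟩
    (a Mult.× 1#) * (b Mult.× 1#) ≡⟨ P.sym (P.cong₂ _*_ (fromℕ≡×1 a) (fromℕ≡×1 b)) ⟩
    fromℕ a * fromℕ b ∎

  fromℕ-^ : ∀ a e → fromℕ (a ℕ.^ e) ≈ pow (fromℕ a) e
  fromℕ-^ a zero = fromℕ-1
  fromℕ-^ a (suc e) = trans (fromℕ-* a _) (*-congˡ (fromℕ-^ a e))

  fromℕ-Σl : {A : Set} (xs : List A) (f : A → ℕ) → fromℕ (ℕΣ.Σl xs f) ≈ Σl xs (fromℕ ∘ f)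
  fromℕ-Σl [] f = refl
  fromℕ-Σl (x ∷ xs) f = trans (fromℕ-+ (f x) _) (+-congˡ (fromℕ-Σl xs f))

  fromℕ-Πl : {A : Set} (xs : List A) (f : A → ℕ) → fromℕ (ℕΣ.Πl xs f) ≈ Πl xs (fromℕ ∘ f)
  fromℕ-Πl [] f = fromℕ-1
  fromℕ-Πl (x ∷ xs) f = trans (fromℕ-* (f x) _) (*-congˡ (fromℕ-Πl xs f))

  pow-cong : ∀ {x y} e → x ≈ y → pow x e ≈ pow y e
  pow-cong {x} {y} e x≈y = begin
    pow x e    ≡⟨ pow≡^ x e ⟩
    x Exp.^ e  ≈⟨ Exp.^-congˡ e x≈y ⟩
    y Exp.^ e  ≡⟨ P.sym (pow≡^ y e) ⟩
    pow y e ∎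

  pow-distrib-* : ∀ x y e → pow (x * y) e ≈ pow x e * pow y e
  pow-distrib-* x y e = begin
    pow (x * y) e              ≡⟨ pow≡^ (x * y) e ⟩
    (x * y) Exp.^ e            ≈⟨ Exp.^-distrib-* x y e ⟩
    x Exp.^ e * y Exp.^ e      ≡⟨ P.sym (P.cong₂ _*_ (pow≡^ x e) (pow≡^ y e)) ⟩
    pow x e * pow y e ∎

  pow-pow : ∀ x a b → pow (pow x a) b ≈ pow x (a ℕ.* b)
  pow-pow x a b = begin
    pow (pow x a) b            ≡⟨ P.trans (pow≡^ (pow x a) b) (P.cong (Exp._^ b) (pow≡^ x a)) ⟩
    (x Exp.^ a) Exp.^ b        ≈⟨ Exp.^-assocʳ x a b ⟩
    x Exp.^ (a ℕ.* b)          ≡⟨ P.sym (pow≡^ x (a ℕ.* b)) ⟩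
    pow x (a ℕ.* b) ∎

  ΠF-const : ∀ n x → ΠF n (λ _ → x) ≈ pow x n
  ΠF-const zero x = refl
  ΠF-const (suc n) x = trans (reflexive (ΠF-suc n (λ _ → x))) (*-congˡ (ΠF-const n x))

  ΠF-pow : ∀ n (f : Fin n → Carrier) q → ΠF n (λ i → pow (f i) q) ≈ pow (ΠF n f) q
  ΠF-pow zero f q = sym (trans (sym (ΠF-const q 1#)) (Πl-1 (allFin q)))
  ΠF-pow (suc n) f q = begin
    ΠF (suc n) (λ i → pow (f i) q)                       ≡⟨ ΠF-suc n _ ⟩
    pow (f zero) q * ΠF n (λ i → pow (f (suc i)) q)      ≈⟨ *-congˡ (ΠF-pow n (f ∘ suc) q) ⟩
    pow (f zero) q * pow (ΠF n (f ∘ suc)) q              ≈⟨ sym (pow-distrib-* _ _ q) ⟩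
    pow (f zero * ΠF n (f ∘ suc)) q                      ≡⟨ P.cong (λ z → pow z q) (P.sym (ΠF-suc n f)) ⟩
    pow (ΠF (suc n) f) q ∎

-- Given a
-- block assignment τ : Fin m → Fin n, the injections f : Fin m → Fin (n·k) with
-- f r in block τ r number ∏_j k(k-1)⋯(k - c_j + 1), where c_j = |τ⁻¹(j)|: place the
-- rows one at a time; row r has k minus (earlier rows in its block) free places.
module InjectionCount where

  open import Data.Nat using (ℕ; zero; suc; _+_; _*_; _∸_)
  open import Data.Nat.Properties using (+-*-commutativeSemiring; *-comm; *-zeroʳ; *-identityˡ; m+n∸n≡m; +-comm)
  open import Data.Fin using (Fin; zero; suc; _≟_; remQuot; combine)
  open import Data.Fin.Properties using (remQuot-combine)
  open import Data.Product using (proj₁)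
  open import Data.Sum using (_⊎_; inj₁; inj₂)
  open import Data.List using (allFin)
  open import Data.Bool using (true; false; if_then_else_)
  open import Data.Bool.Properties using (∧-conicalˡ; ∧-conicalʳ)
  open import Function using (_∘_)
  open import Relation.Binary.PropositionalEquality
  open import Relation.Nullary.Decidable using (⌊_⌋)
  open import Relation.Nullary using (yes; no)
  open BooleanTests
  open BigOperators.Sums +-*-commutativeSemiring

  δ : {M : ℕ} → Fin M → Fin M → ℕ
  δ a b = if ⌊ a ≟ b ⌋ then 1 else 0

  δ-sym : {M : ℕ} (a b : Fin M) → δ a b ≡ δ b a
  δ-sym a b = cong (λ e → if e then 1 else 0) (⌊⌋-cong (a ≟ b) (b ≟ a) sym sym)

  ΣF-1 : ∀ m → ΣF m (λ _ → 1) ≡ m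
  ΣF-1 zero = refl
  ΣF-1 (suc m) = trans (ΣF-suc m (λ _ → 1)) (cong suc (ΣF-1 m))

  fibre : {m n : ℕ} → (Fin m → Fin n) → Fin n → ℕ
  fibre {m} τ j = ΣF m (λ r → δ (τ r) j)

  -- falling k c = k (k-1) ⋯ (k-c+1), the number of injections Fin c → Fin k.
  falling : ℕ → ℕ → ℕ
  falling k zero = 1
  falling k (suc c) = falling k c * (k ∸ c)

  sum-over-image : {m M : ℕ} (f : Fin m → Fin M) → injectiveᵇ f ≡ true → (g : Fin M → ℕ) →
    ΣF M (λ x → if avoidsᵇ x f then 0 else g x) ≡ ΣF m (g ∘ f)
  sum-over-image {zero} {M} f _ g = Σl-0 (allFin M)
  sum-over-image {suc m} {M} f inj g = begin
    ΣF M (λ x → if avoidsᵇ x f then 0 else g x)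
      ≡⟨ ΣF-cong M split ⟩
    ΣF M (λ x → (if ⌊ x ≟ f zero ⌋ then g x else 0) + (if avoidsᵇ x (f ∘ suc) then 0 else g x))
      ≡⟨ Σl-+ (allFin M) _ _ ⟩
    ΣF M (λ x → if ⌊ x ≟ f zero ⌋ then g x else 0) + ΣF M (λ x → if avoidsᵇ x (f ∘ suc) then 0 else g x)
      ≡⟨ cong₂ _+_ (ΣF-δ M (f zero) g) (sum-over-image (f ∘ suc) (∧-conicalʳ _ _ inj) g) ⟩
    g (f zero) + ΣF m (λ r → g (f (suc r)))
      ≡⟨ sym (ΣF-suc m (g ∘ f)) ⟩
    ΣF (suc m) (g ∘ f) ∎
    where
    open ≡-Reasoning
    first-avoids : avoidsᵇ (f zero) (f ∘ suc) ≡ true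
    first-avoids = ∧-conicalˡ _ _ inj
    split : ∀ x → (if avoidsᵇ x f then 0 else g x)
                ≡ (if ⌊ x ≟ f zero ⌋ then g x else 0) + (if avoidsᵇ x (f ∘ suc) then 0 else g x)
    split x with x ≟ f zero
    ... | yes refl rewrite ⌊⌋-true (f zero ≟ f zero) refl | first-avoids = sym (+-comm (g (f zero)) 0)
    ... | no ne rewrite ⌊⌋-false (f zero ≟ x) (ne ∘ sym) = refl

  module Blocks (n k : ℕ) where

    blk : Fin (n * k) → Fin n
    blk r = proj₁ (remQuot {n} k r)

    inBlocks : {m : ℕ} → (Fin m → Fin n) → (Fin m → Fin (n * k)) → ℕ
    inBlocks {m} τ f = ΠF m (λ r → δ (blk (f r)) (τ r))

    blockInjections : {m : ℕ} → (Fin m → Fin n) → ℕ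
    blockInjections {m} τ = ΣA m (n * k) (λ f → if injectiveᵇ f then inBlocks τ f else 0)

    inBlocks-dichotomy : {m : ℕ} (τ : Fin m → Fin n) (f : Fin m → Fin (n * k)) →
      inBlocks τ f ≡ 0 ⊎ (∀ r → blk (f r) ≡ τ r)
    inBlocks-dichotomy {zero} τ f = inj₂ (λ ())
    inBlocks-dichotomy {suc m} τ f rewrite ΠF-suc m (λ r → δ (blk (f r)) (τ r))
      with blk (f zero) ≟ τ zero | inBlocks-dichotomy (τ ∘ suc) (f ∘ suc)
    ... | no _ | _ = inj₁ refl
    ... | yes e | inj₁ z = inj₁ (trans (*-identityˡ _) z)
    ... | yes e | inj₂ a = inj₂ (λ { zero → e ; (suc r) → a r })

    inBlocks-cong : {m : ℕ} (τ : Fin m → Fin n) {f g : Fin m → Fin (n * k)} → (∀ i → f i ≡ g i) →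
      inBlocks τ f ≡ inBlocks τ g
    inBlocks-cong {m} τ e = ΠF-cong m (λ r → cong (λ z → δ (blk z) (τ r)) (e r))

    block-size : (j : Fin n) → ΣF (n * k) (λ x → δ (blk x) j) ≡ k
    block-size j = begin
      ΣF (n * k) (λ x → δ (blk x) j)                         ≡⟨ ΣF-combine n k _ ⟩
      ΣF n (λ i → ΣF k (λ c → δ (blk (combine i c)) j))
        ≡⟨ ΣF-cong n (λ i → ΣF-cong k (λ c → cong (λ p → δ (proj₁ p) j) (remQuot-combine i c))) ⟩
      ΣF n (λ i → ΣF k (λ c → δ i j))                        ≡⟨ ΣF-cong n as-if ⟩
      ΣF n (λ i → if ⌊ i ≟ j ⌋ then k else 0)                ≡⟨ ΣF-δ n j (λ _ → k) ⟩
      k ∎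
      where
      open ≡-Reasoning
      as-if : ∀ i → ΣF k (λ _ → δ i j) ≡ (if ⌊ i ≟ j ⌋ then k else 0)
      as-if i with ⌊ i ≟ j ⌋
      ... | true = ΣF-1 k
      ... | false = Σl-0 (allFin k)

    free-positions : {m : ℕ} (τ : Fin m → Fin n) (f : Fin m → Fin (n * k)) → injectiveᵇ f ≡ true →
      (∀ r → blk (f r) ≡ τ r) → (j : Fin n) →
      ΣF (n * k) (λ x → if avoidsᵇ x f then δ (blk x) j else 0) ≡ k ∸ fibre τ j
    free-positions {m} τ f inj resp j = begin
      Free                                  ≡⟨ m+n∸n≡m Free Used ⟨
      (Free + Used) ∸ Used                  ≡⟨ cong (_∸ Used) (ΣF-split-if (n * k) (λ x → avoidsᵇ x f) (λ x → δ (blk x) j)) ⟩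
      ΣF (n * k) (λ x → δ (blk x) j) ∸ Used ≡⟨ cong₂ _∸_ (block-size j) used ⟩
      k ∸ fibre τ j ∎
      where
      open ≡-Reasoning
      Free = ΣF (n * k) (λ x → if avoidsᵇ x f then δ (blk x) j else 0)
      Used = ΣF (n * k) (λ x → if avoidsᵇ x f then 0 else δ (blk x) j)
      used : Used ≡ fibre τ j
      used = trans (sum-over-image f inj (λ x → δ (blk x) j)) (ΣF-cong m (λ r → cong (λ z → δ z j) (resp r)))

    summand-cong : {m : ℕ} (τ : Fin m → Fin n) → Resp {m} {n * k} (λ f → if injectiveᵇ f then inBlocks τ f else 0)
    summand-cong τ {f} {g} e rewrite injectiveᵇ-cong e with injectiveᵇ g
    ... | true = inBlocks-cong τ e
    ... | false = refl

    admissible-cons : {m : ℕ} (τ : Fin (suc m) → Fin n) (f : Fin m → Fin (n * k)) (x : Fin (n * k)) →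
      (if injectiveᵇ (cons x f) then inBlocks τ (cons x f) else 0)
        ≡ (if injectiveᵇ f then inBlocks (τ ∘ suc) f else 0) * (if avoidsᵇ x f then δ (blk x) (τ zero) else 0)
    admissible-cons {m} τ f x rewrite ΠF-suc m (λ r → δ (blk (cons x f r)) (τ r)) with avoidsᵇ x f | injectiveᵇ f
    ... | true  | true  = *-comm (δ (blk x) (τ zero)) _
    ... | true  | false = refl
    ... | false | true  = sym (*-zeroʳ (inBlocks (τ ∘ suc) f))
    ... | false | false = refl

    choices-for-first-row : {m : ℕ} (τ : Fin (suc m) → Fin n) (f : Fin m → Fin (n * k)) →
      let X = if injectiveᵇ f then inBlocks (τ ∘ suc) f else 0 in
      X * ΣF (n * k) (λ x → if avoidsᵇ x f then δ (blk x) (τ zero) else 0) ≡ X * (k ∸ fibre (τ ∘ suc) (τ zero))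
    choices-for-first-row τ f with injectiveᵇ f in inj
    ... | false = refl
    ... | true with inBlocks-dichotomy (τ ∘ suc) f
    ...   | inj₁ zero-weight rewrite zero-weight = refl
    ...   | inj₂ resp = cong (inBlocks (τ ∘ suc) f *_) (free-positions (τ ∘ suc) f inj resp (τ zero))

    -- Place the other rows first; the first row then has k - fibre (τ ∘ suc) (τ zero) choices.
    blockInjections-suc : {m : ℕ} (τ : Fin (suc m) → Fin n) →
      blockInjections τ ≡ blockInjections (τ ∘ suc) * (k ∸ fibre (τ ∘ suc) (τ zero))
    blockInjections-suc {m} τ = begin
      blockInjections τ
        ≡⟨ ΣA-suc m (n * k) _ (summand-cong τ) ⟩
      ΣA m (n * k) (λ f → ΣF (n * k) (λ x → if injectiveᵇ (cons x f) then inBlocks τ (cons x f) else 0))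
        ≡⟨ ΣA-cong m (n * k) (λ f → ΣF-cong (n * k) (admissible-cons τ f)) ⟩
      ΣA m (n * k) (λ f → ΣF (n * k) (λ x → X f * Y f x))
        ≡⟨ ΣA-cong m (n * k) (λ f → Σl-*ˡ (allFin (n * k)) (X f) (Y f)) ⟨
      ΣA m (n * k) (λ f → X f * ΣF (n * k) (Y f))
        ≡⟨ ΣA-cong m (n * k) (choices-for-first-row τ) ⟩
      ΣA m (n * k) (λ f → X f * c)
        ≡⟨ Σl-*ʳ (allFuns m (n * k)) c X ⟨
      blockInjections (τ ∘ suc) * c ∎
      where
      open ≡-Reasoning
      c = k ∸ fibre (τ ∘ suc) (τ zero)
      X : (Fin m → Fin (n * k)) → ℕ
      X f = if injectiveᵇ f then inBlocks (τ ∘ suc) f else 0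
      Y : (Fin m → Fin (n * k)) → Fin (n * k) → ℕ
      Y f x = if avoidsᵇ x f then δ (blk x) (τ zero) else 0

    falling-fibre-suc : {m : ℕ} (τ : Fin (suc m) → Fin n) (j : Fin n) →
      (if ⌊ j ≟ τ zero ⌋ then (k ∸ fibre (τ ∘ suc) (τ zero)) * falling k (fibre (τ ∘ suc) j)
                          else falling k (fibre (τ ∘ suc) j))
        ≡ falling k (fibre τ j)
    falling-fibre-suc {m} τ j rewrite ΣF-suc m (λ r → δ (τ r) j) with j ≟ τ zero
    ... | yes refl rewrite ⌊⌋-true (τ zero ≟ τ zero) refl = *-comm (k ∸ fibre (τ ∘ suc) (τ zero)) _
    ... | no j≢τ₀ rewrite ⌊⌋-false (τ zero ≟ j) (j≢τ₀ ∘ sym) = refl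

    count-block-injections : (m : ℕ) (τ : Fin m → Fin n) →
      blockInjections τ ≡ ΠF n (λ j → falling k (fibre τ j))
    count-block-injections zero τ = sym (Πl-1 (allFin n))
    count-block-injections (suc m) τ = begin
      blockInjections τ                                            ≡⟨ blockInjections-suc τ ⟩
      blockInjections (τ ∘ suc) * c                                ≡⟨ cong (_* c) (count-block-injections m (τ ∘ suc)) ⟩
      ΠF n (λ j → falling k (fibre (τ ∘ suc) j)) * c               ≡⟨ *-comm _ c ⟩
      c * ΠF n (λ j → falling k (fibre (τ ∘ suc) j))               ≡⟨ ΠF-update n (τ zero) c _ ⟨
      ΠF n (λ j → if ⌊ j ≟ τ zero ⌋ then c * falling k (fibre (τ ∘ suc) j) else falling k (fibre (τ ∘ suc) j))
                                                                   ≡⟨ ΠF-cong n (falling-fibre-suc τ) ⟩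
      ΠF n (λ j → falling k (fibre τ j)) ∎
      where
      open ≡-Reasoning
      c = k ∸ fibre (τ ∘ suc) (τ zero)

module ChoiceCount where

  open import Data.Nat as ℕ using (ℕ; zero; suc; _+_; _*_; _∸_; _≤_; _<_; z≤n; s≤s; _!; _^_)
  open import Data.Nat.Properties hiding (_≟_)
  open import Data.Fin using (Fin; zero; suc; _≟_; combine; toℕ)
  open import Data.Fin.Properties using (remQuot-combine; any?)
  open import Data.Product using (proj₁; _,_)
  open import Data.List using (allFin)
  open import Data.Bool using (true; false; if_then_else_)
  open import Function using (_∘_)
  open import Relation.Binary.PropositionalEquality
  open import Relation.Nullary.Decidable using (⌊_⌋)
  open import Relation.Nullary using (yes; no; contradiction)
  open BooleanTests
  open InjectionCount
  open BigOperators.Sums +-*-commutativeSemiring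

  falling-! : ∀ k c → c ≤ k → falling k c * (k ∸ c) ! ≡ k !
  falling-! k zero _ = +-identityʳ (k !)
  falling-! k (suc c) c<k = begin
    falling k c * (k ∸ c) * (k ∸ suc c) !      ≡⟨ *-assoc (falling k c) _ _ ⟩
    falling k c * ((k ∸ c) * (k ∸ suc c) !)    ≡⟨ cong (λ z → falling k c * (z * (k ∸ suc c) !)) k∸c≡1+ ⟩
    falling k c * (suc (k ∸ suc c) !)          ≡⟨ cong (λ z → falling k c * (z !)) (sym k∸c≡1+) ⟩
    falling k c * (k ∸ c) !                    ≡⟨ falling-! k c (≤-trans (n≤1+n c) c<k) ⟩
    k ! ∎
    where
    open ≡-Reasoning
    k∸c≡1+ : k ∸ c ≡ suc (k ∸ suc c)
    k∸c≡1+ = +-∸-assoc 1 c<k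

  falling-self : ∀ k → falling k k ≡ k !
  falling-self k = begin
    falling k k                ≡⟨ *-identityʳ (falling k k) ⟨
    falling k k * 1            ≡⟨ cong (λ z → falling k k * (z !)) (n∸n≡0 k) ⟨
    falling k k * (k ∸ k) !    ≡⟨ falling-! k k ≤-refl ⟩
    k ! ∎
    where open ≡-Reasoning

  falling-beyond : ∀ k c → k < c → falling k c ≡ 0
  falling-beyond k (suc c) (s≤s k≤c) rewrite m≤n⇒m∸n≡0 k≤c = *-zeroʳ (falling k c)

  ΠF-zero : ∀ n (f : Fin n → ℕ) j → f j ≡ 0 → ΠF n f ≡ 0
  ΠF-zero (suc n) f zero e = trans (ΠF-suc n f) (cong (_* ΠF n (f ∘ suc)) e)
  ΠF-zero (suc n) f (suc j) e = trans (ΠF-suc n f) (trans (cong (f zero *_) (ΠF-zero n (f ∘ suc) j e)) (*-zeroʳ (f zero)))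

  ΠF-const : ∀ n x → ΠF n (λ _ → x) ≡ x ^ n
  ΠF-const zero x = refl
  ΠF-const (suc n) x = trans (ΠF-suc n (λ _ → x)) (cong (x *_) (ΠF-const n x))

  ΣF-bound : ∀ n k (c : Fin n → ℕ) → (∀ j → c j ≤ k) → ΣF n c ≤ n * k
  ΣF-bound zero k c h = z≤n
  ΣF-bound (suc n) k c h = subst (_≤ k + n * k) (sym (ΣF-suc n c)) (+-mono-≤ (h zero) (ΣF-bound n k (c ∘ suc) (h ∘ suc)))

  all-equal-of-sum : ∀ n k (c : Fin n → ℕ) → (∀ j → c j ≤ k) → ΣF n c ≡ n * k → ∀ j → c j ≡ k
  all-equal-of-sum (suc n) k c h e = go
    where
    e' : c zero + ΣF n (c ∘ suc) ≡ k + n * k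
    e' = trans (sym (ΣF-suc n c)) e
    rest≤ = ΣF-bound n k (c ∘ suc) (h ∘ suc)
    first : c zero ≡ k
    first = ≤-antisym (h zero) (+-cancelʳ-≤ (n * k) k (c zero) (subst (_≤ c zero + n * k) e' (+-monoʳ-≤ (c zero) rest≤)))
    rest : ΣF n (c ∘ suc) ≡ n * k
    rest = ≤-antisym rest≤ (+-cancelˡ-≤ k (n * k) _ (subst (_≤ k + ΣF n (c ∘ suc)) e' (+-monoˡ-≤ (ΣF n (c ∘ suc)) (h zero))))
    go : ∀ j → c j ≡ k
    go zero = first
    go (suc j) = all-equal-of-sum n k (c ∘ suc) (h ∘ suc) rest j

  falling-product : ∀ n k (c : Fin n → ℕ) → ΣF n c ≡ n * k →
    ΠF n (λ j → falling k (c j)) ≡ (if allᵇ n (λ j → ⌊ c j ℕ.≟ k ⌋) then (k !) ^ n else 0)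
  falling-product n k c e with any? (λ j → k ℕ.<? c j)
  ... | yes (j , k<cj) = begin
      ΠF n (λ j → falling k (c j))   ≡⟨ ΠF-zero n (λ j → falling k (c j)) j (falling-beyond k (c j) k<cj) ⟩
      0                              ≡⟨ cong (λ b → if b then (k !) ^ n else 0) not-all ⟨
      (if allᵇ n (λ j → ⌊ c j ℕ.≟ k ⌋) then (k !) ^ n else 0) ∎
    where
    open ≡-Reasoning
    not-all : allᵇ n (λ j → ⌊ c j ℕ.≟ k ⌋) ≡ false
    not-all with allᵇ n (λ j → ⌊ c j ℕ.≟ k ⌋) in eq
    ... | false = refl
    ... | true = contradiction (⌊⌋-sound (c j ℕ.≟ k) (allᵇ-elim n _ eq j)) (>⇒≢ k<cj)
  ... | no none-big = begin
      ΠF n (λ j → falling k (c j))   ≡⟨ ΠF-cong n (λ j → trans (cong (falling k) (all-k j)) (falling-self k)) ⟩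
      ΠF n (λ j → k !)               ≡⟨ ΠF-const n (k !) ⟩
      (k !) ^ n                      ≡⟨ cong (λ b → if b then (k !) ^ n else 0) all ⟨
      (if allᵇ n (λ j → ⌊ c j ℕ.≟ k ⌋) then (k !) ^ n else 0) ∎
    where
    open ≡-Reasoning
    all-k : ∀ j → c j ≡ k
    all-k = all-equal-of-sum n k c (λ j → ≮⇒≥ (λ k<cj → none-big (j , k<cj))) e
    all : allᵇ n (λ j → ⌊ c j ℕ.≟ k ⌋) ≡ true
    all = allᵇ-intro n _ (λ j → ⌊⌋-true (c j ℕ.≟ k) (all-k j))

  count₁ : {k : ℕ} → (Fin k → Fin 2) → ℕ
  count₁ {k} s = ΣF k (toℕ ∘ s)

  count₁-bound : ∀ {k} (s : Fin k → Fin 2) → count₁ s ≤ k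
  count₁-bound {k} s = subst (count₁ s ≤_) (*-identityʳ k) (ΣF-bound k 1 (toℕ ∘ s) (λ c → bit≤1 (s c)))
    where
    bit≤1 : (b : Fin 2) → toℕ b ≤ 1
    bit≤1 zero = z≤n
    bit≤1 (suc zero) = s≤s z≤n

  count₀ : ∀ {k} (s : Fin k → Fin 2) → ΣF k (λ c → 1 ∸ toℕ (s c)) ≡ k ∸ count₁ s
  count₀ {k} s = begin
    Zeros                 ≡⟨ m+n∸n≡m Zeros (count₁ s) ⟨
    (Zeros + count₁ s) ∸ count₁ s
      ≡⟨ cong (_∸ count₁ s) (trans (sym (Σl-+ (allFin k) _ _)) (trans (ΣF-cong k (λ c → bits (s c))) (ΣF-1 k))) ⟩
    k ∸ count₁ s ∎
    where
    open ≡-Reasoning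
    Zeros = ΣF k (λ c → 1 ∸ toℕ (s c))
    bits : (b : Fin 2) → (1 ∸ toℕ b) + toℕ b ≡ 1
    bits zero = refl
    bits (suc zero) = refl

  blockCount : {n k : ℕ} → (Fin (n * k) → Fin 2) → Fin n → ℕ
  blockCount {n} {k} S i = count₁ (λ c → S (combine i c))

  ΣF-fibres : ∀ n m (τ : Fin m → Fin n) → ΣF n (fibre τ) ≡ m
  ΣF-fibres n m τ = begin
    ΣF n (λ j → ΣF m (λ r → δ (τ r) j))   ≡⟨ Σl-swap (allFin n) (allFin m) _ ⟩
    ΣF m (λ r → ΣF n (λ j → δ (τ r) j))   ≡⟨ ΣF-cong m (λ r → trans (ΣF-cong n (λ j → δ-sym (τ r) j)) (ΣF-δ n (τ r) (λ _ → 1))) ⟩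
    ΣF m (λ _ → 1)                        ≡⟨ ΣF-1 m ⟩
    m ∎
    where open ≡-Reasoning

  x*δ : ∀ {M} (x : ℕ) (i j : Fin M) → x * δ i j ≡ (if ⌊ i ≟ j ⌋ then x else 0)
  x*δ x i j with ⌊ i ≟ j ⌋
  ... | true = *-identityʳ x
  ... | false = *-zeroʳ x

  balance : ∀ k a b → a ≤ k → b ≤ k → ⌊ (k ∸ a) + b ℕ.≟ k ⌋ ≡ ⌊ b ℕ.≟ a ⌋
  balance k a b a≤k b≤k = ⌊⌋-cong ((k ∸ a) + b ℕ.≟ k) (b ℕ.≟ a)
    (λ e → +-cancelˡ-≡ (k ∸ a) b a (trans e (sym (m∸n+n≡m a≤k))))
    (λ e → trans (cong ((k ∸ a) +_) e) (m∸n+n≡m a≤k))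

  -- Each row r chooses S r ∈ {0,1}: its own block (0) or the block π (blk r) (1).
  -- π is a permutation of Fin n with inverse ρ.
  module Choices (n k : ℕ) (π ρ : Fin n → Fin n)
                 (π⇒ρ : ∀ i j → π i ≡ j → i ≡ ρ j) (ρ⇒π : ∀ i j → i ≡ ρ j → π i ≡ j) where
    open Blocks n k

    target : Fin 2 → Fin n → Fin n
    target zero i = i
    target (suc zero) i = π i

    targets : (Fin (n * k) → Fin 2) → Fin (n * k) → Fin n
    targets S r = target (S r) (blk r)

    δ-target : ∀ s i j → δ (target s i) j ≡ (1 ∸ toℕ s) * δ i j + toℕ s * δ (π i) j
    δ-target zero i j = sym (trans (+-identityʳ _) (+-identityʳ _))
    δ-target (suc zero) i j = sym (+-identityʳ _)

    -- Block i sends k - u_i rows to block i and u_i rows to block π i.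
    block-contribution : ∀ S i j → ΣF k (λ c → δ (targets S (combine i c)) j)
      ≡ (if ⌊ i ≟ j ⌋ then k ∸ blockCount S i else 0) + (if ⌊ i ≟ ρ j ⌋ then blockCount S i else 0)
    block-contribution S i j = begin
      ΣF k (λ c → δ (target (s c) (blk (combine i c))) j)
        ≡⟨ ΣF-cong k (λ c → cong (λ z → δ (target (s c) (proj₁ z)) j) (remQuot-combine i c)) ⟩
      ΣF k (λ c → δ (target (s c) i) j)
        ≡⟨ ΣF-cong k (λ c → δ-target (s c) i j) ⟩
      ΣF k (λ c → (1 ∸ toℕ (s c)) * δ i j + toℕ (s c) * δ (π i) j)
        ≡⟨ Σl-+ (allFin k) _ _ ⟩
      ΣF k (λ c → (1 ∸ toℕ (s c)) * δ i j) + ΣF k (λ c → toℕ (s c) * δ (π i) j)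
        ≡⟨ cong₂ _+_ (Σl-*ʳ (allFin k) (δ i j) _) (Σl-*ʳ (allFin k) (δ (π i) j) _) ⟨
      ΣF k (λ c → 1 ∸ toℕ (s c)) * δ i j + count₁ s * δ (π i) j
        ≡⟨ cong₂ _+_ (trans (cong (_* δ i j) (count₀ s)) (x*δ _ i j))
                     (trans (cong (λ e → count₁ s * (if e then 1 else 0)) (⌊⌋-cong (π i ≟ j) (i ≟ ρ j) (π⇒ρ i j) (ρ⇒π i j)))
                            (x*δ _ i (ρ j))) ⟩
      (if ⌊ i ≟ j ⌋ then k ∸ count₁ s else 0) + (if ⌊ i ≟ ρ j ⌋ then count₁ s else 0) ∎
      where
      open ≡-Reasoning
      s = λ c → S (combine i c)

    -- Block j receives its own non-moving rows and the moving rows of block ρ j.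
    fibre-targets : ∀ S j → fibre (targets S) j ≡ (k ∸ blockCount S j) + blockCount S (ρ j)
    fibre-targets S j = begin
      ΣF (n * k) (λ r → δ (targets S r) j)
        ≡⟨ ΣF-combine n k _ ⟩
      ΣF n (λ i → ΣF k (λ c → δ (targets S (combine i c)) j))
        ≡⟨ ΣF-cong n (λ i → block-contribution S i j) ⟩
      ΣF n (λ i → (if ⌊ i ≟ j ⌋ then k ∸ blockCount S i else 0) + (if ⌊ i ≟ ρ j ⌋ then blockCount S i else 0))
        ≡⟨ Σl-+ (allFin n) _ _ ⟩
      _ ≡⟨ cong₂ _+_ (ΣF-δ n j (λ i → k ∸ blockCount S i)) (ΣF-δ n (ρ j) (blockCount S)) ⟩
      (k ∸ blockCount S j) + blockCount S (ρ j) ∎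
      where open ≡-Reasoning

    choice-count : ∀ S → ΠF n (λ j → falling k (fibre (targets S) j))
      ≡ (if allᵇ n (λ j → ⌊ blockCount S (ρ j) ℕ.≟ blockCount S j ⌋) then (k !) ^ n else 0)
    choice-count S = trans (falling-product n k (fibre (targets S)) (ΣF-fibres n (n * k) (targets S)))
      (cong (λ b → if b then (k !) ^ n else 0) (allᵇ-cong n balanced))
      where
      balanced : ∀ j → ⌊ fibre (targets S) j ℕ.≟ k ⌋ ≡ ⌊ blockCount S (ρ j) ℕ.≟ blockCount S j ⌋
      balanced j = trans (cong (λ z → ⌊ z ℕ.≟ k ⌋) (fibre-targets S j))
        (balance k (blockCount S j) (blockCount S (ρ j)) (count₁-bound _) (count₁-bound _))

module Binomial {c ℓ : Level} (R : CommutativeRing c ℓ) where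

  open import Data.Nat as ℕ using (ℕ; zero; suc)
  import Data.Nat.Properties as ℕP
  open import Data.Nat.Combinatorics using (_C_; nCk+nC[k+1]≡[n+1]C[k+1]; k>n⇒nCk≡0)
  open import Data.Fin using (Fin; zero; suc; toℕ; combine)
  open import Data.Fin.Properties using (splitAt-↑ˡ; splitAt-↑ʳ)
  open import Data.List using (allFin)
  open import Data.Sum using ([_,_]′)
  open import Function using (_∘_)
  import Relation.Binary.PropositionalEquality as P
  open P using (_≡_)
  open CommutativeRing R hiding (zero)
  open RingDefs R using (fromℕ; pow)
  open RingFacts R
  open ChoiceCount using (count₁; count₁-bound; blockCount)
  open import Relation.Binary.Reasoning.Setoid setoid

  Σ< : ℕ → (ℕ → Carrier) → Carrier
  Σ< m g = ΣF m (g ∘ toℕ)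

  Σ<-cong : ∀ m {g h : ℕ → Carrier} → (∀ l → g l ≈ h l) → Σ< m g ≈ Σ< m h
  Σ<-cong m e = ΣF-cong m (e ∘ toℕ)

  Σ<-suc : ∀ m g → Σ< (suc m) g ≡ g 0 + Σ< m (g ∘ suc)
  Σ<-suc m g = ΣF-suc m (g ∘ toℕ)

  Σ<-last : ∀ m g → Σ< (suc m) g ≈ Σ< m g + g m
  Σ<-last zero g = trans (+-identityʳ _) (sym (+-identityˡ _))
  Σ<-last (suc m) g = begin
    Σ< (suc (suc m)) g                   ≡⟨ Σ<-suc (suc m) g ⟩
    g 0 + Σ< (suc m) (g ∘ suc)           ≈⟨ +-congˡ (Σ<-last m (g ∘ suc)) ⟩
    g 0 + (Σ< m (g ∘ suc) + g (suc m))   ≈⟨ sym (+-assoc _ _ _) ⟩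
    g 0 + Σ< m (g ∘ suc) + g (suc m)     ≡⟨ P.cong (_+ g (suc m)) (P.sym (Σ<-suc m g)) ⟩
    Σ< (suc m) g + g (suc m) ∎

  pascal-sum : ∀ k (φ : ℕ → Carrier) →
    Σ< (suc k) (λ l → fromℕ (k C l) * φ l) + Σ< (suc k) (λ l → fromℕ (k C l) * φ (suc l))
      ≈ Σ< (suc (suc k)) (λ l → fromℕ (suc k C l) * φ l)
  pascal-sum k φ = begin
    Σ< (suc k) (λ l → fromℕ (k C l) * φ l) + Shifted
      ≡⟨ P.cong (_+ Shifted) (Σ<-suc k (λ l → fromℕ (k C l) * φ l)) ⟩
    fromℕ 1 * φ 0 + Σ< k (λ l → fromℕ (k C suc l) * φ (suc l)) + Shifted
      ≈⟨ +-congʳ (+-congˡ (sym top-vanishes)) ⟩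
    fromℕ 1 * φ 0 + Upper + Shifted
      ≈⟨ +-assoc _ _ _ ⟩
    fromℕ 1 * φ 0 + (Upper + Shifted)
      ≈⟨ +-congˡ (trans (+-comm _ _) (sym (Σl-+ (allFin (suc k)) _ _))) ⟩
    fromℕ 1 * φ 0 + Σ< (suc k) (λ l → fromℕ (k C l) * φ (suc l) + fromℕ (k C suc l) * φ (suc l))
      ≈⟨ +-congˡ (Σ<-cong (suc k) pascal) ⟩
    fromℕ 1 * φ 0 + Σ< (suc k) (λ l → fromℕ (suc k C suc l) * φ (suc l))
      ≡⟨ P.sym (Σ<-suc (suc k) (λ l → fromℕ (suc k C l) * φ l)) ⟩
    Σ< (suc (suc k)) (λ l → fromℕ (suc k C l) * φ l) ∎
    where
    Upper = Σ< (suc k) (λ l → fromℕ (k C suc l) * φ (suc l))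
    Shifted = Σ< (suc k) (λ l → fromℕ (k C l) * φ (suc l))
    -- the extra last term of Upper carries C(k, k+1) = 0
    top-vanishes : Upper ≈ Σ< k (λ l → fromℕ (k C suc l) * φ (suc l))
    top-vanishes = begin
      Upper                                                         ≈⟨ Σ<-last k (λ l → fromℕ (k C suc l) * φ (suc l)) ⟩
      Σ< k (λ l → fromℕ (k C suc l) * φ (suc l)) + fromℕ (k C suc k) * φ (suc k)
        ≈⟨ +-congˡ (trans (*-congʳ (reflexive (P.cong fromℕ (k>n⇒nCk≡0 (ℕP.n<1+n k))))) (zeroˡ _)) ⟩
      Σ< k (λ l → fromℕ (k C suc l) * φ (suc l)) + 0#               ≈⟨ +-identityʳ _ ⟩
      Σ< k (λ l → fromℕ (k C suc l) * φ (suc l)) ∎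
    pascal : ∀ l → fromℕ (k C l) * φ (suc l) + fromℕ (k C suc l) * φ (suc l) ≈ fromℕ (suc k C suc l) * φ (suc l)
    pascal l = begin
      fromℕ (k C l) * φ (suc l) + fromℕ (k C suc l) * φ (suc l) ≈⟨ sym (distribʳ _ _ _) ⟩
      (fromℕ (k C l) + fromℕ (k C suc l)) * φ (suc l)           ≈⟨ *-congʳ (sym (fromℕ-+ (k C l) (k C suc l))) ⟩
      fromℕ (k C l ℕ.+ k C suc l) * φ (suc l)                   ≡⟨ P.cong (λ z → fromℕ z * φ (suc l)) (nCk+nC[k+1]≡[n+1]C[k+1] k l) ⟩
      fromℕ (suc k C suc l) * φ (suc l) ∎

  count₁-cong : {k : ℕ} {s s' : Fin k → Fin 2} → (∀ i → s i ≡ s' i) → count₁ s ≡ count₁ s'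
  count₁-cong {k} e = ℕΣ.ΣF-cong k (λ i → P.cong toℕ (e i))

  -- There are C(k,l) vectors s : Fin k → {0,1} with l ones.
  sum-by-count₁ : ∀ k (φ : ℕ → Carrier) → ΣA k 2 (λ s → φ (count₁ s)) ≈ Σ< (suc k) (λ l → fromℕ (k C l) * φ l)
  sum-by-count₁ zero φ = +-congʳ (sym (trans (*-congʳ fromℕ-1) (*-identityˡ _)))
  sum-by-count₁ (suc k) φ = begin
    ΣA (suc k) 2 (λ s → φ (count₁ s))
      ≈⟨ ΣA-suc k 2 _ (λ e → reflexive (P.cong φ (count₁-cong e))) ⟩
    ΣA k 2 (λ s → ΣF 2 (λ x → φ (count₁ (cons x s))))
      ≈⟨ ΣA-cong k 2 (λ s → reflexive (P.cong₂ _+_ (P.cong φ (ℕΣ.ΣF-suc k (toℕ ∘ cons zero s)))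
                                                   (P.cong (λ z → φ z + 0#) (ℕΣ.ΣF-suc k (toℕ ∘ cons (suc zero) s))))) ⟩
    ΣA k 2 (λ s → φ (count₁ s) + (φ (suc (count₁ s)) + 0#))
      ≈⟨ ΣA-cong k 2 (λ s → +-congˡ (+-identityʳ _)) ⟩
    ΣA k 2 (λ s → φ (count₁ s) + φ (suc (count₁ s)))
      ≈⟨ Σl-+ (allFuns k 2) _ _ ⟩
    ΣA k 2 (λ s → φ (count₁ s)) + ΣA k 2 (λ s → φ (suc (count₁ s)))
      ≈⟨ +-cong (sum-by-count₁ k φ) (sum-by-count₁ k (φ ∘ suc)) ⟩
    Σ< (suc k) (λ l → fromℕ (k C l) * φ l) + Σ< (suc k) (λ l → fromℕ (k C l) * φ (suc l))
      ≈⟨ pascal-sum k φ ⟩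
    Σ< (suc (suc k)) (λ l → fromℕ (suc k C l) * φ l) ∎

  consℕ : {n : ℕ} → ℕ → (Fin n → ℕ) → Fin (suc n) → ℕ
  consℕ x f zero = x
  consℕ x f (suc i) = f i

  RespN : {n : ℕ} → ((Fin n → ℕ) → Carrier) → Set ℓ
  RespN {n} Φ = ∀ {w w' : Fin n → ℕ} → (∀ i → w i ≡ w' i) → Φ w ≈ Φ w'

  blockCount-join : (n k : ℕ) (s : Fin k → Fin 2) (S : Fin (n ℕ.* k) → Fin 2) →
    ∀ i → blockCount {suc n} {k} (join s S) i ≡ consℕ (count₁ s) (blockCount {n} {k} S) i
  blockCount-join n k s S zero = ℕΣ.ΣF-cong k (λ c → P.cong (λ z → toℕ ([ s , S ]′ z)) (splitAt-↑ˡ k c (n ℕ.* k)))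
  blockCount-join n k s S (suc i) = ℕΣ.ΣF-cong k (λ c → P.cong (λ z → toℕ ([ s , S ]′ z)) (splitAt-↑ʳ k (n ℕ.* k) (combine i c)))

  sum-by-blockCounts : (n k : ℕ) (Φ : (Fin n → ℕ) → Carrier) → RespN Φ →
    ΣA (n ℕ.* k) 2 (λ S → Φ (blockCount {n} {k} S))
      ≈ ΣA n (suc k) (λ v → ΠF n (λ i → fromℕ (k C toℕ (v i))) * Φ (toℕ ∘ v))
  sum-by-blockCounts zero k Φ r = +-congʳ (trans (r (λ ())) (sym (*-identityˡ _)))
  sum-by-blockCounts (suc n) k Φ r = begin
    ΣA (k ℕ.+ n ℕ.* k) 2 (λ S → Φ (blockCount {suc n} {k} S))
      ≈⟨ ΣA-split k (n ℕ.* k) 2 _ (λ e → r (λ i → ℕΣ.ΣF-cong k (λ c → P.cong toℕ (e _)))) ⟩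
    ΣA k 2 (λ s → ΣA (n ℕ.* k) 2 (λ S → Φ (blockCount {suc n} {k} (join s S))))
      ≈⟨ ΣA-cong k 2 (λ s → ΣA-cong (n ℕ.* k) 2 (λ S → r (blockCount-join n k s S))) ⟩
    ΣA k 2 (λ s → ΣA (n ℕ.* k) 2 (λ S → Φ (consℕ (count₁ s) (blockCount {n} {k} S))))
      ≈⟨ ΣA-cong k 2 (λ s → sum-by-blockCounts n k (λ w → Φ (consℕ (count₁ s) w)) (λ e → r (λ { zero → P.refl ; (suc i) → e i }))) ⟩
    ΣA k 2 (λ s → ΣA n (suc k) (λ v → Coef v * Φ (consℕ (count₁ s) (toℕ ∘ v))))
      ≈⟨ Σl-swap (allFuns k 2) (allFuns n (suc k)) _ ⟩
    ΣA n (suc k) (λ v → ΣA k 2 (λ s → Coef v * Φ (consℕ (count₁ s) (toℕ ∘ v))))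
      ≈⟨ ΣA-cong n (suc k) (λ v → sym (Σl-*ˡ (allFuns k 2) (Coef v) _)) ⟩
    ΣA n (suc k) (λ v → Coef v * ΣA k 2 (λ s → Φ (consℕ (count₁ s) (toℕ ∘ v))))
      ≈⟨ ΣA-cong n (suc k) (λ v → *-congˡ (sum-by-count₁ k (λ l → Φ (consℕ l (toℕ ∘ v))))) ⟩
    ΣA n (suc k) (λ v → Coef v * ΣF (suc k) (λ x → fromℕ (k C toℕ x) * Φ (consℕ (toℕ x) (toℕ ∘ v))))
      ≈⟨ ΣA-cong n (suc k) (λ v → trans (Σl-*ˡ (allFin (suc k)) (Coef v) _) (ΣF-cong (suc k) (regroup v))) ⟩
    ΣA n (suc k) (λ v → ΣF (suc k) (λ x → ΠF (suc n) (λ i → fromℕ (k C toℕ (cons x v i))) * Φ (toℕ ∘ cons x v)))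
      ≈⟨ sym (ΣA-suc n (suc k) _ (λ e → *-cong (ΠF-cong (suc n) (λ i → reflexive (P.cong (λ z → fromℕ (k C toℕ z)) (e i))))
                                                (r (λ i → P.cong toℕ (e i))))) ⟩
    ΣA (suc n) (suc k) (λ v → ΠF (suc n) (λ i → fromℕ (k C toℕ (v i))) * Φ (toℕ ∘ v)) ∎
    where
    Coef : (Fin n → Fin (suc k)) → Carrier
    Coef v = ΠF n (λ i → fromℕ (k C toℕ (v i)))
    regroup : ∀ v x → Coef v * (fromℕ (k C toℕ x) * Φ (consℕ (toℕ x) (toℕ ∘ v)))
                     ≈ ΠF (suc n) (λ i → fromℕ (k C toℕ (cons x v i))) * Φ (toℕ ∘ cons x v)
    regroup v x = begin
      Coef v * (fromℕ (k C toℕ x) * Φ (consℕ (toℕ x) (toℕ ∘ v)))   ≈⟨ sym (*-assoc _ _ _) ⟩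
      Coef v * fromℕ (k C toℕ x) * Φ (consℕ (toℕ x) (toℕ ∘ v))     ≈⟨ *-cong (*-comm _ _) (r (λ { zero → P.refl ; (suc i) → P.refl })) ⟩
      fromℕ (k C toℕ x) * Coef v * Φ (toℕ ∘ cons x v)
        ≡⟨ P.cong (_* Φ (toℕ ∘ cons x v)) (P.sym (ΠF-suc n (λ i → fromℕ (k C toℕ (cons x v i))))) ⟩
      ΠF (suc n) (λ i → fromℕ (k C toℕ (cons x v i))) * Φ (toℕ ∘ cons x v) ∎

  module Weights (a₀ aₜ : Carrier) where
    coef : Fin 2 → Carrier
    coef zero = a₀
    coef (suc zero) = aₜ

    block-weight : ∀ k (s : Fin k → Fin 2) → ΠF k (coef ∘ s) ≈ pow a₀ (k ℕ.∸ count₁ s) * pow aₜ (count₁ s)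
    block-weight zero s = sym (*-identityˡ _)
    block-weight (suc k) s =
      trans (reflexive (ΠF-suc k (coef ∘ s))) (trans (*-congˡ (block-weight k (s ∘ suc))) (first (s zero) P.refl))
      where
      u = count₁ (s ∘ suc)
      first : ∀ x → s zero ≡ x → coef (s zero) * (pow a₀ (k ℕ.∸ u) * pow aₜ u)
                                  ≈ pow a₀ (suc k ℕ.∸ count₁ s) * pow aₜ (count₁ s)
      first zero e rewrite ℕΣ.ΣF-suc k (toℕ ∘ s) | e | ℕP.+-∸-assoc 1 (count₁-bound (s ∘ suc)) = sym (*-assoc _ _ _)
      first (suc zero) e rewrite ℕΣ.ΣF-suc k (toℕ ∘ s) | e = x∙yz≈y∙xz aₜ (pow a₀ (k ℕ.∸ u)) (pow aₜ u)
        where open import Algebra.Properties.CommutativeSemigroup *-commutativeSemigroup using (x∙yz≈y∙xz)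

    weight : ∀ n k (S : Fin (n ℕ.* k) → Fin 2) →
      ΠF (n ℕ.* k) (coef ∘ S) ≈ ΠF n (λ i → pow a₀ (k ℕ.∸ blockCount {n} {k} S i) * pow aₜ (blockCount {n} {k} S i))
    weight n k S = trans (ΠF-combine n k _) (ΠF-cong n (λ i → block-weight k (λ c → S (combine i c))))

module CyclicShift where

  open import Data.Nat as ℕ using (ℕ; zero; suc; _+_; _∸_; _≤_; _<_; s≤s; _%_)
  open import Data.Nat.Properties
  open import Data.Nat.DivMod using (m%n<n; %-distribˡ-+; m%n%n≡m%n; m<n⇒m%n≡m; n%n≡0)
  open import Data.Nat.Divisibility using (_∣_; _∣?_; ∣⇒≤; _∣0; ∣-refl)
  open import Data.Integer as ℤ using (ℤ; +_; -[1+_]; _⊖_)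
  open import Data.Integer.Properties using (⊖-≥; ⊖-<)
  import Data.Integer.Properties as ℤP
  open import Data.Fin as F using (Fin; zero; suc; toℕ; fromℕ<)
  open import Data.Fin.Properties using (toℕ-injective; toℕ-fromℕ<; toℕ<n)
  open import Relation.Binary.PropositionalEquality
  open import Relation.Nullary.Decidable using (⌊_⌋)
  open import Relation.Nullary using (yes; no)
  open import Data.Empty using (⊥-elim)
  open import Data.Sum using (_⊎_; inj₁; inj₂)
  open BooleanTests using (⌊⌋-cong)

  module Shift (n′ : ℕ) where
    n = suc n′

    sh : Fin n → Fin n
    sh i = fromℕ< (m%n<n (suc (toℕ i)) n)

    toℕ-sh : ∀ i → toℕ (sh i) ≡ suc (toℕ i) % n
    toℕ-sh i = toℕ-fromℕ< (m%n<n (suc (toℕ i)) n)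

    iter : ℕ → Fin n → Fin n
    iter zero i = i
    iter (suc t) i = iter t (sh i)

    %-absorbˡ : ∀ a b → (a % n + b) % n ≡ (a + b) % n
    %-absorbˡ a b = begin
      (a % n + b) % n          ≡⟨ %-distribˡ-+ (a % n) b n ⟩
      (a % n % n + b % n) % n  ≡⟨ cong (λ z → (z + b % n) % n) (m%n%n≡m%n a n) ⟩
      (a % n + b % n) % n      ≡⟨ %-distribˡ-+ a b n ⟨
      (a + b) % n ∎
      where open ≡-Reasoning

    toℕ-iter : ∀ t i → toℕ (iter t i) ≡ (toℕ i + t) % n
    toℕ-iter zero i = trans (sym (m<n⇒m%n≡m (toℕ<n i))) (cong (_% n) (sym (+-identityʳ (toℕ i))))
    toℕ-iter (suc t) i = begin
      toℕ (iter t (sh i))           ≡⟨ toℕ-iter t (sh i) ⟩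
      (toℕ (sh i) + t) % n          ≡⟨ cong (λ z → (z + t) % n) (toℕ-sh i) ⟩
      (suc (toℕ i) % n + t) % n     ≡⟨ %-absorbˡ (suc (toℕ i)) t ⟩
      (suc (toℕ i) + t) % n         ≡⟨ cong (_% n) (sym (+-suc (toℕ i) t)) ⟩
      (toℕ i + suc t) % n ∎
      where open ≡-Reasoning

    P-difference : ∀ a i → ℤ._-_ (ℤ._-_ (+ a) (+ i)) ℤ.1ℤ ≡ a ⊖ suc i
    P-difference a i = trans (ℤP.+-assoc (+ a) (ℤ.- (+ i)) (ℤ.- ℤ.1ℤ)) (cong (ℤ._+_ (+ a)) (neg-suc i))
      where
      neg-suc : ∀ i → ℤ._+_ (ℤ.- (+ i)) (ℤ.- ℤ.1ℤ) ≡ -[1+ i ]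
      neg-suc zero = refl
      neg-suc (suc i) = cong (λ z → -[1+ suc z ]) (+-identityʳ i)

    ∣-+∣ : ∀ x → ℤ.∣ ℤ.- (+ x) ∣ ≡ x
    ∣-+∣ zero = refl
    ∣-+∣ (suc x) = refl

    multiple-upto-n : ∀ D → D ≤ n → n ∣ D → D ≡ 0 ⊎ D ≡ n
    multiple-upto-n zero _ _ = inj₁ refl
    multiple-upto-n (suc D) D≤n n∣D = inj₂ (≤-antisym D≤n (∣⇒≤ n∣D))

    n∸a≡n⇒a≡0 : ∀ a → n ∸ a ≡ n → a ≡ 0
    n∸a≡n⇒a≡0 zero _ = refl
    n∸a≡n⇒a≡0 (suc a) e = ⊥-elim (<-irrefl e (s≤s (m∸n≤m n′ a)))

    divides-distance⇒ : ∀ a b → a < n → b ≤ n → n ∣ ℤ.∣ a ⊖ b ∣ → a ≡ b % n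
    divides-distance⇒ a b a<n b≤n n∣D with b ≤? a
    ... | yes b≤a rewrite ⊖-≥ b≤a with multiple-upto-n (a ∸ b) (≤-trans (m∸n≤m a b) (<⇒≤ a<n)) n∣D
    ...   | inj₁ a∸b≡0 = trans (sym (m∸n+n≡m b≤a)) (trans (cong (_+ b) a∸b≡0) (sym (m<n⇒m%n≡m (≤-<-trans b≤a a<n))))
    ...   | inj₂ a∸b≡n = ⊥-elim (<-irrefl a∸b≡n (≤-<-trans (m∸n≤m a b) a<n))
    divides-distance⇒ a b a<n b≤n n∣D | no b≰a rewrite ⊖-< (≰⇒> b≰a) | ∣-+∣ (b ∸ a)
      with multiple-upto-n (b ∸ a) (≤-trans (m∸n≤m b a) b≤n) n∣D
    ...   | inj₁ b∸a≡0 = ⊥-elim (<⇒≢ (≰⇒> b≰a) (sym (trans (sym (m∸n+n≡m (<⇒≤ (≰⇒> b≰a)))) (cong (_+ a) b∸a≡0))))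
    ...   | inj₂ b∸a≡n = subst (λ z → a ≡ z % n) (sym b≡n) (trans a≡0 (sym (n%n≡0 n)))
      where
      b≡n : b ≡ n
      b≡n = ≤-antisym b≤n (subst (_≤ b) b∸a≡n (m∸n≤m b a))
      a≡0 : a ≡ 0
      a≡0 = n∸a≡n⇒a≡0 a (trans (cong (_∸ a) (sym b≡n)) b∸a≡n)

    divides-distance⇐ : ∀ a b → a < n → b ≤ n → a ≡ b % n → n ∣ ℤ.∣ a ⊖ b ∣
    divides-distance⇐ a b a<n b≤n e with m≤n⇒m<n∨m≡n b≤n
    ... | inj₁ b<n rewrite m<n⇒m%n≡m b<n | e | ⊖-≥ (≤-refl {b}) | n∸n≡0 b = n ∣0
    ... | inj₂ b≡n = subst₂ (λ x y → n ∣ ℤ.∣ x ⊖ y ∣) (sym a≡0) (sym b≡n) ∣-refl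
      where
      a≡0 : a ≡ 0
      a≡0 = trans e (trans (cong (_% n) b≡n) (n%n≡0 n))

    P-entry : ∀ (i j : Fin n) → ⌊ n ∣? ℤ.∣ ℤ._-_ (ℤ._-_ (+ toℕ j) (+ toℕ i)) ℤ.1ℤ ∣ ⌋ ≡ ⌊ j F.≟ sh i ⌋
    P-entry i j rewrite P-difference (toℕ j) (toℕ i) = ⌊⌋-cong (n ∣? ℤ.∣ toℕ j ⊖ suc (toℕ i) ∣) (j F.≟ sh i)
      (λ n∣D → toℕ-injective (trans (divides-distance⇒ (toℕ j) (suc (toℕ i)) (toℕ<n j) (toℕ<n i) n∣D) (sym (toℕ-sh i))))
      (λ j≡sh → divides-distance⇐ (toℕ j) (suc (toℕ i)) (toℕ<n j) (toℕ<n i) (trans (cong toℕ j≡sh) (toℕ-sh i)))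

-- The orbits of π = shᵗ on Fin n are the residue classes modulo d = gcd(n, t):
-- π preserves i mod d, and by Bézout some multiple of t is ≡ d (mod n), so every i
-- is reached from rep i = i mod d.  Hence a function is π-invariant iff it factors
-- through rep.
module Orbits where

  open import Data.Nat as ℕ using (ℕ; zero; suc; _+_; _*_; _≤_; z≤n; s≤s; _%_; _/_; NonZero)
  open import Data.Nat.Properties
  open import Data.Nat.DivMod using (m%n<n; %-distribˡ-*; m<n⇒m%n≡m; [m+kn]%n≡m%n; m≡m%n+[m/n]*n; %-remove-+ʳ)
  open import Data.Nat.Divisibility using (_∣_; ∣⇒≤; ∣-trans; n∣m*n)
  open import Data.Nat.GCD using (gcd; gcd-GCD; gcd[m,n]∣m; gcd[m,n]∣n; module Bézout)
  open import Data.Fin using (Fin; toℕ; fromℕ<)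
  open import Data.Fin.Properties using (toℕ-injective; toℕ-fromℕ<; toℕ<n)
  open import Data.Product using (∃; _,_; proj₁; proj₂)
  open import Relation.Binary.PropositionalEquality
  open import Data.Nat.Solver using (module +-*-Solver)
  open +-*-Solver

  module Orbit (n′ t : ℕ) where
    open CyclicShift.Shift n′ public

    d : ℕ
    d = gcd n t

    instance
      d-nonZero : NonZero d
      d-nonZero = gcd-nonZero n t (s≤s z≤n)

    d∣n : d ∣ n
    d∣n = gcd[m,n]∣m n t

    d∣t : d ∣ t
    d∣t = gcd[m,n]∣n n t

    d≤n : d ≤ n
    d≤n = ∣⇒≤ d∣n

    π ρ : Fin n → Fin n
    π = iter t
    ρ = iter (n′ * t)

    iter-+ : ∀ a b i → iter a (iter b i) ≡ iter (b + a) i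
    iter-+ a zero i = refl
    iter-+ a (suc b) i = iter-+ a b (sh i)

    iter-nt : ∀ i → iter (n * t) i ≡ i
    iter-nt i = toℕ-injective (begin
      toℕ (iter (n * t) i)   ≡⟨ toℕ-iter (n * t) i ⟩
      (toℕ i + n * t) % n    ≡⟨ cong (λ z → (toℕ i + z) % n) (*-comm n t) ⟩
      (toℕ i + t * n) % n    ≡⟨ [m+kn]%n≡m%n (toℕ i) t n ⟩
      toℕ i % n              ≡⟨ m<n⇒m%n≡m (toℕ<n i) ⟩
      toℕ i ∎)
      where open ≡-Reasoning

    π∘ρ : ∀ j → π (ρ j) ≡ j
    π∘ρ j = trans (iter-+ t (n′ * t) j) (trans (cong (λ z → iter z j) (+-comm (n′ * t) t)) (iter-nt j))

    ρ∘π : ∀ i → ρ (π i) ≡ i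
    ρ∘π i = trans (iter-+ (n′ * t) t i) (iter-nt i)

    π⇒ρ : ∀ i j → π i ≡ j → i ≡ ρ j
    π⇒ρ i j e = trans (sym (ρ∘π i)) (cong ρ e)

    ρ⇒π : ∀ i j → i ≡ ρ j → π i ≡ j
    ρ⇒π i j e = trans (cong π e) (π∘ρ j)

    rep : Fin n → Fin n
    rep i = fromℕ< (≤-trans (m%n<n (toℕ i) d) d≤n)

    toℕ-rep : ∀ i → toℕ (rep i) ≡ toℕ i % d
    toℕ-rep i = toℕ-fromℕ< (≤-trans (m%n<n (toℕ i) d) d≤n)

    %n%d : ∀ y → y % n % d ≡ y % d
    %n%d y = sym (trans (cong (_% d) (m≡m%n+[m/n]*n y n)) (%-remove-+ʳ (y % n) (∣-trans d∣n (n∣m*n (y / n)))))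

    rep-π : ∀ i → rep (π i) ≡ rep i
    rep-π i = toℕ-injective (begin
      toℕ (rep (π i))        ≡⟨ toℕ-rep (π i) ⟩
      toℕ (π i) % d          ≡⟨ cong (_% d) (toℕ-iter t i) ⟩
      (toℕ i + t) % n % d    ≡⟨ %n%d (toℕ i + t) ⟩
      (toℕ i + t) % d        ≡⟨ %-remove-+ʳ (toℕ i) d∣t ⟩
      toℕ i % d              ≡⟨ toℕ-rep i ⟨
      toℕ (rep i) ∎)
      where open ≡-Reasoning

    bezout : ∃ λ α → (α * t) % n ≡ d % n
    bezout with Bézout.identity (gcd-GCD n t)
    ... | Bézout.+- x y eq = n′ * y , (begin
        (n′ * y * t) % n            ≡⟨ [m+kn]%n≡m%n (n′ * y * t) x n ⟨
        (n′ * y * t + x * n) % n    ≡⟨ cong (_% n) rearrange ⟩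
        (d + (y * t) * n) % n       ≡⟨ [m+kn]%n≡m%n d (y * t) n ⟩
        d % n ∎)
      where
      open ≡-Reasoning
      rearrange : n′ * y * t + x * n ≡ d + (y * t) * n
      rearrange = begin
        n′ * y * t + x * n          ≡⟨ cong (n′ * y * t +_) (sym eq) ⟩
        n′ * y * t + (d + y * t)    ≡⟨ solve 4 (λ n′ y t d → n′ :* y :* t :+ (d :+ y :* t) := d :+ (y :* t) :* (con 1 :+ n′)) refl n′ y t d ⟩
        d + (y * t) * n ∎
    ... | Bézout.-+ x y eq = y , (begin
        (y * t) % n                 ≡⟨ cong (_% n) (sym eq) ⟩
        (d + x * n) % n             ≡⟨ [m+kn]%n≡m%n d x n ⟩
        d % n ∎)
      where open ≡-Reasoning

    α : ℕ
    α = proj₁ bezout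

    %-absorbʳ : ∀ a b → (a + b % n) % n ≡ (a + b) % n
    %-absorbʳ a b = trans (cong (_% n) (+-comm a (b % n))) (trans (%-absorbˡ b a) (cong (_% n) (+-comm b a)))

    reach : ∀ i → iter ((α * (toℕ i / d)) * t) (rep i) ≡ i
    reach i = toℕ-injective (begin
      toℕ (iter (α * Q * t) (rep i))                  ≡⟨ toℕ-iter (α * Q * t) (rep i) ⟩
      (toℕ (rep i) + α * Q * t) % n                   ≡⟨ cong (λ z → (z + α * Q * t) % n) (toℕ-rep i) ⟩
      (r + α * Q * t) % n                             ≡⟨ cong (λ z → (r + z) % n) (solve 3 (λ a q t → a :* q :* t := q :* (a :* t)) refl α Q t) ⟩
      (r + Q * (α * t)) % n                           ≡⟨ %-absorbʳ r (Q * (α * t)) ⟨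
      (r + (Q * (α * t)) % n) % n                     ≡⟨ cong (λ z → (r + z) % n) (%-distribˡ-* Q (α * t) n) ⟩
      (r + ((Q % n) * ((α * t) % n)) % n) % n         ≡⟨ cong (λ z → (r + ((Q % n) * z) % n) % n) (proj₂ bezout) ⟩
      (r + ((Q % n) * (d % n)) % n) % n               ≡⟨ cong (λ z → (r + z) % n) (%-distribˡ-* Q d n) ⟨
      (r + (Q * d) % n) % n                           ≡⟨ %-absorbʳ r (Q * d) ⟩
      (r + Q * d) % n                                 ≡⟨ cong (_% n) (m≡m%n+[m/n]*n (toℕ i) d) ⟨
      toℕ i % n                                       ≡⟨ m<n⇒m%n≡m (toℕ<n i) ⟩
      toℕ i ∎)
      where
      open ≡-Reasoning
      Q = toℕ i / d
      r = toℕ i % d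

    module _ {A : Set} (v : Fin n → A) where
      invariant-iter : (∀ i → v (π i) ≡ v i) → ∀ x j → v (iter (x * t) j) ≡ v j
      invariant-iter h zero j = refl
      invariant-iter h (suc x) j = trans (cong v (sym (iter-+ (x * t) t j))) (trans (invariant-iter h x (π j)) (h j))

      invariant⇒factors : (∀ i → v (π i) ≡ v i) → ∀ i → v i ≡ v (rep i)
      invariant⇒factors h i = trans (cong v (sym (reach i))) (invariant-iter h (α * (toℕ i / d)) (rep i))

      factors⇒invariant : (∀ i → v i ≡ v (rep i)) → ∀ i → v (π i) ≡ v i
      factors⇒invariant h i = trans (h (π i)) (trans (cong v (rep-π i)) (sym (h i)))

      ρ-invariant⇒π-invariant : (∀ j → v (ρ j) ≡ v j) → ∀ i → v (π i) ≡ v i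
      ρ-invariant⇒π-invariant h i = trans (sym (h (π i))) (cong v (ρ∘π i))

      π-invariant⇒ρ-invariant : (∀ i → v (π i) ≡ v i) → ∀ j → v (ρ j) ≡ v j
      π-invariant⇒ρ-invariant h j = trans (sym (h (ρ j))) (cong v (π∘ρ j))

-- Sums over π-invariant functions v : Fin n → Fin K.  Such v are determined by their
-- values on the representatives 0, …, d-1, and each residue class has n/d elements.
module InvariantSums {c ℓ : Level} (R : CommutativeRing c ℓ) where

  open import Data.Nat as ℕ using (ℕ; _%_; _/_)
  import Data.Nat.Properties as ℕP
  open import Data.Nat.DivMod using (m%n<n; m<n⇒m%n≡m; [m+kn]%n≡m%n; m/n*n≡m; m%n%n≡m%n)
  open import Data.Fin as F using (Fin; toℕ; fromℕ<; _↑ˡ_; _↑ʳ_; splitAt; combine)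
  open import Data.Fin.Properties using (toℕ-injective; toℕ-fromℕ<; toℕ<n; toℕ-↑ˡ; toℕ-combine; join-splitAt; splitAt-↑ˡ; splitAt-↑ʳ)
  open import Data.Bool using (Bool; true; false; if_then_else_)
  open import Data.Sum using (inj₁; inj₂; [_,_]′)
  open import Function using (_∘_)
  import Relation.Binary.PropositionalEquality as P
  open P using (_≡_)
  open import Relation.Nullary.Decidable using (⌊_⌋)
  open CommutativeRing R hiding (zero)
  open RingDefs R using (pow)
  open RingFacts R
  open BooleanTests
  open import Relation.Binary.Reasoning.Setoid setoid

  +-elim : {d e : ℕ} (Q : Fin (d ℕ.+ e) → Set) → (∀ c → Q (c ↑ˡ e)) → (∀ j → Q (d ↑ʳ j)) → ∀ i → Q i
  +-elim {d} {e} Q left right i with splitAt d i in eq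
  ... | inj₁ c = P.subst Q (P.trans (P.cong (F.join d e) (P.sym eq)) (join-splitAt d e i)) (left c)
  ... | inj₂ j = P.subst Q (P.trans (P.cong (F.join d e) (P.sym eq)) (join-splitAt d e i)) (right j)

  module _ {d e K : ℕ} (w : Fin d → Fin K) (z : Fin e → Fin K) where
    join-↑ˡ : ∀ c → join w z (c ↑ˡ e) ≡ w c
    join-↑ˡ c = P.cong [ w , z ]′ (splitAt-↑ˡ d c e)

    join-↑ʳ : ∀ j → join w z (d ↑ʳ j) ≡ z j
    join-↑ʳ j = P.cong [ w , z ]′ (splitAt-↑ʳ d e j)

  retract-sum : ∀ {K} d e (red : Fin (d ℕ.+ e) → Fin d) → (∀ c → red (c ↑ˡ e) ≡ c) →
    (G : (Fin (d ℕ.+ e) → Fin K) → Carrier) → Resp G →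
    ΣA (d ℕ.+ e) K (λ v → if eqᵇ v (λ i → v (red i ↑ˡ e)) then G v else 0#) ≈ ΣA d K (λ w → G (w ∘ red))
  retract-sum {K} d e red fix G r = begin
    ΣA (d ℕ.+ e) K (λ v → if eqᵇ v (λ i → v (red i ↑ˡ e)) then G v else 0#)
      ≈⟨ ΣA-split d e K _ resp ⟩
    ΣA d K (λ w → ΣA e K (λ z → if eqᵇ (join w z) (λ i → join w z (red i ↑ˡ e)) then G (join w z) else 0#))
      ≈⟨ ΣA-cong d K (λ w → ΣA-cong e K (λ z → reflexive (P.cong (λ b → if b then G (join w z) else 0#) (condition w z)))) ⟩
    ΣA d K (λ w → ΣA e K (λ z → if eqᵇ z (extend w) then G (join w z) else 0#))
      ≈⟨ ΣA-cong d K (λ w → ΣA-δ e K (extend w) (λ z → G (join w z)) (λ x → r (join-congʳ w x))) ⟩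
    ΣA d K (λ w → G (join w (extend w)))
      ≈⟨ ΣA-cong d K (λ w → r (+-elim _ (λ c → P.trans (join-↑ˡ w _ c) (P.cong w (P.sym (fix c)))) (join-↑ʳ w _))) ⟩
    ΣA d K (λ w → G (w ∘ red)) ∎
    where
    extend : (Fin d → Fin K) → Fin e → Fin K
    extend w j = w (red (d ↑ʳ j))
    join-congʳ : ∀ w {z z' : Fin e → Fin K} → (∀ j → z j ≡ z' j) → ∀ i → join w z i ≡ join w z' i
    join-congʳ w {z} {z'} e = +-elim _ (λ c → P.trans (join-↑ˡ w z c) (P.sym (join-↑ˡ w z' c)))
                                       (λ j → P.trans (join-↑ʳ w z j) (P.trans (e j) (P.sym (join-↑ʳ w z' j))))
    condition : ∀ w z → eqᵇ (join w z) (λ i → join w z (red i ↑ˡ e)) ≡ eqᵇ z (extend w)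
    condition w z = bool-iff
      (λ p → eqᵇ-complete z (extend w) (λ j →
        P.trans (P.sym (join-↑ʳ w z j)) (P.trans (eqᵇ-sound _ _ p (d ↑ʳ j)) (join-↑ˡ w z _))))
      (λ p → eqᵇ-complete _ _ (+-elim _
        (λ c → P.trans (join-↑ˡ w z c) (P.sym (P.trans (join-↑ˡ w z _) (P.cong w (fix c)))))
        (λ j → P.trans (join-↑ʳ w z j) (P.trans (eqᵇ-sound z (extend w) p j) (P.sym (join-↑ˡ w z _))))))
    resp : Resp (λ v → if eqᵇ v (λ i → v (red i ↑ˡ e)) then G v else 0#)
    resp {f} {g} x rewrite eqᵇ-cong x (λ i → x (red i ↑ˡ e)) with eqᵇ g (λ i → g (red i ↑ˡ e))
    ... | true = r x
    ... | false = refl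

  retract-sum′ : ∀ {K} N e d → N ≡ d ℕ.+ e → (red : Fin N → Fin N) (red′ : Fin N → Fin d) →
    (∀ i → toℕ (red i) ≡ toℕ (red′ i)) → (∀ i → toℕ i ℕ.< d → red i ≡ i) →
    (G : (Fin N → Fin K) → Carrier) → Resp G →
    ΣA N K (λ v → if eqᵇ v (v ∘ red) then G v else 0#) ≈ ΣA d K (λ w → G (w ∘ red′))
  retract-sum′ {K} ._ e d P.refl red red′ same fixes G r =
    trans (ΣA-cong (d ℕ.+ e) K (λ v → reflexive (P.cong (λ b → if b then G v else 0#)
                                                       (eqᵇ-cong (λ _ → P.refl) (λ i → P.cong v (embed i))))))
          (retract-sum d e red′ fix G r)
    where
    embed : ∀ i → red i ≡ red′ i ↑ˡ e
    embed i = toℕ-injective (P.trans (same i) (P.sym (toℕ-↑ˡ (red′ i) e)))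
    fix : ∀ c → red′ (c ↑ˡ e) ≡ c
    fix c = toℕ-injective (P.trans (P.sym (same (c ↑ˡ e)))
      (P.trans (P.cong toℕ (fixes (c ↑ˡ e) (P.subst (ℕ._< d) (P.sym (toℕ-↑ˡ c e)) (toℕ<n c)))) (toℕ-↑ˡ c e)))

  product-mod : ∀ N q d .{{_ : ℕ.NonZero d}} → N ≡ q ℕ.* d → (F : ℕ → Carrier) →
    ΠF N (λ i → F (toℕ i % d)) ≈ pow (ΠF d (F ∘ toℕ)) q
  product-mod ._ q d P.refl F = begin
    ΠF (q ℕ.* d) (λ i → F (toℕ i % d))                    ≈⟨ ΠF-combine q d _ ⟩
    ΠF q (λ a → ΠF d (λ c → F (toℕ (combine a c) % d)))   ≈⟨ ΠF-cong q (λ a → ΠF-cong d (λ c → reflexive (P.cong F (combine-mod a c)))) ⟩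
    ΠF q (λ a → ΠF d (F ∘ toℕ))                           ≈⟨ ΠF-const q _ ⟩
    pow (ΠF d (F ∘ toℕ)) q ∎
    where
    combine-mod : ∀ (a : Fin q) (c : Fin d) → toℕ (combine a c) % d ≡ toℕ c
    combine-mod a c = P.trans (P.cong (_% d) (P.trans (toℕ-combine a c)
                                (P.trans (ℕP.+-comm (d ℕ.* toℕ a) (toℕ c)) (P.cong (toℕ c ℕ.+_) (ℕP.*-comm d (toℕ a))))))
                              (P.trans ([m+kn]%n≡m%n (toℕ c) (toℕ a) d) (m<n⇒m%n≡m (toℕ<n c)))

  module OrbitSum (n′ t K : ℕ) (g : Fin K → Carrier) where
    open Orbits.Orbit n′ t

    -- The invariance test produced by the counting argument: w ∘ ρ = w.
    invariantᵇ : (Fin n → ℕ) → Bool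
    invariantᵇ w = allᵇ n (λ j → ⌊ w (ρ j) ℕ.≟ w j ⌋)

    q : ℕ
    q = n / d

    mod-d : ℕ → Fin d
    mod-d m = fromℕ< (m%n<n m d)

    mod-d-% : ∀ m → mod-d (m % d) ≡ mod-d m
    mod-d-% m = toℕ-injective (P.trans (toℕ-fromℕ< _) (P.trans (m%n%n≡m%n m d) (P.sym (toℕ-fromℕ< _))))

    mod-d-toℕ : ∀ (c : Fin d) → mod-d (toℕ c) ≡ c
    mod-d-toℕ c = toℕ-injective (P.trans (toℕ-fromℕ< _) (m<n⇒m%n≡m (toℕ<n c)))

    invariantᵇ≡factorsᵇ : ∀ (v : Fin n → Fin K) → invariantᵇ (toℕ ∘ v) ≡ eqᵇ v (v ∘ rep)
    invariantᵇ≡factorsᵇ v = bool-iff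
      (λ p → eqᵇ-complete v (v ∘ rep) (invariant⇒factors v (ρ-invariant⇒π-invariant v (λ j →
        toℕ-injective (⌊⌋-sound (toℕ (v (ρ j)) ℕ.≟ toℕ (v j))
                                (allᵇ-elim n (λ j → ⌊ toℕ (v (ρ j)) ℕ.≟ toℕ (v j) ⌋) p j))))))
      (λ p → allᵇ-intro n (λ j → ⌊ toℕ (v (ρ j)) ℕ.≟ toℕ (v j) ⌋) (λ j → ⌊⌋-true (toℕ (v (ρ j)) ℕ.≟ toℕ (v j))
        (P.cong toℕ (π-invariant⇒ρ-invariant v (factors⇒invariant v (eqᵇ-sound v (v ∘ rep) p)) j))))

    product-over-classes : ∀ (w : Fin d → Fin K) → ΠF n (λ i → g (w (mod-d (toℕ i)))) ≈ pow (ΠF d (g ∘ w)) q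
    product-over-classes w = begin
      ΠF n (λ i → g (w (mod-d (toℕ i))))          ≈⟨ ΠF-cong n (λ i → reflexive (P.cong (g ∘ w) (P.sym (mod-d-% (toℕ i))))) ⟩
      ΠF n (λ i → g (w (mod-d (toℕ i % d))))      ≈⟨ product-mod n q d (P.sym (m/n*n≡m d∣n)) (g ∘ w ∘ mod-d) ⟩
      pow (ΠF d (λ c → g (w (mod-d (toℕ c))))) q  ≈⟨ pow-cong q (ΠF-cong d (λ c → reflexive (P.cong (g ∘ w) (mod-d-toℕ c)))) ⟩
      pow (ΠF d (g ∘ w)) q ∎

    invariant-sum : ΣA n K (λ v → if invariantᵇ (toℕ ∘ v) then ΠF n (g ∘ v) else 0#) ≈ pow (ΣF K (λ l → pow (g l) q)) d
    invariant-sum = begin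
      ΣA n K (λ v → if invariantᵇ (toℕ ∘ v) then ΠF n (g ∘ v) else 0#)
        ≈⟨ ΣA-cong n K (λ v → reflexive (P.cong (λ b → if b then ΠF n (g ∘ v) else 0#) (invariantᵇ≡factorsᵇ v))) ⟩
      ΣA n K (λ v → if eqᵇ v (v ∘ rep) then ΠF n (g ∘ v) else 0#)
        ≈⟨ retract-sum′ n (n ℕ.∸ d) d (P.sym (ℕP.m+[n∸m]≡n d≤n)) rep (mod-d ∘ toℕ)
             (λ i → P.trans (toℕ-rep i) (P.sym (toℕ-fromℕ< _))) (λ i i<d → toℕ-injective (P.trans (toℕ-rep i) (m<n⇒m%n≡m i<d)))
             (λ v → ΠF n (g ∘ v)) (λ e → ΠF-cong n (λ i → reflexive (P.cong g (e i)))) ⟩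
      ΣA d K (λ w → ΠF n (λ i → g (w (mod-d (toℕ i)))))
        ≈⟨ ΣA-cong d K (λ w → trans (product-over-classes w) (sym (ΠF-pow d (g ∘ w) q))) ⟩
      ΣA d K (λ w → ΠF d (λ c → pow (g (w c)) q))
        ≈⟨ sym (prod-of-sums d K (λ c l → pow (g l) q)) ⟩
      ΠF d (λ c → ΣF K (λ l → pow (g l) q))
        ≈⟨ ΠF-const d _ ⟩
      pow (ΣF K (λ l → pow (g l) q)) d ∎

module PermanentFormula {c ℓ : Level} (R : CommutativeRing c ℓ) (n′ t k : ℕ) (a₀ aₜ : CommutativeRing.Carrier R) where

  import Data.Nat as ℕ
  open import Data.Nat.Combinatorics using (_C_)
  open import Data.Nat.DivMod using (m/n*n≡m)
  open import Data.Fin as F using (Fin; zero; suc; toℕ)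
  open import Data.Bool using (true; false; if_then_else_)
  open import Data.List using (allFin)
  open import Function using (_∘_)
  import Relation.Binary.PropositionalEquality as P
  open import Relation.Nullary.Decidable using (⌊_⌋)
  open CommutativeRing R hiding (zero)
  open RingDefs R
  open RingFacts R
  open import Relation.Binary.Reasoning.Setoid setoid
  open BooleanTests using (injectiveᵇ; isInjᵇ≡injectiveᵇ; ⌊⌋-cong; allᵇ-cong)
  open InjectionCount using (δ; module Blocks)
  open ChoiceCount using (blockCount; module Choices)
  open Binomial R using (sum-by-blockCounts; module Weights)
  open Orbits.Orbit n′ t
  open Blocks n k
  open Choices n k π ρ π⇒ρ ρ⇒π
  open Weights a₀ aₜ
  open InvariantSums R using (module OrbitSum)

  N : ℕ
  N = n ℕ.* k

  δR : ∀ {m} → Fin m → Fin m → Carrier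
  δR a b = if ⌊ a F.≟ b ⌋ then 1# else 0#

  fromℕ-δ : ∀ {m} (a b : Fin m) → fromℕ (δ a b) ≈ δR a b
  fromℕ-δ a b with ⌊ a F.≟ b ⌋
  ... | true = fromℕ-1
  ... | false = refl

  matPow-P : ∀ s i j → matPow (P n) s i j ≈ δR j (iter s i)
  matPow-P ℕ.zero i j = reflexive (P.cong (λ b → if b then 1# else 0#) (⌊⌋-cong (i F.≟ j) (j F.≟ i) P.sym P.sym))
  matPow-P (ℕ.suc s) i j = begin
    ΣF n (λ l → P n i l * matPow (P n) s l j)             ≈⟨ ΣF-cong n (λ l → trans (*-cong (reflexive (P-row l)) (matPow-P s l j)) (select l)) ⟩
    ΣF n (λ l → if ⌊ l F.≟ sh i ⌋ then δR j (iter s l) else 0#) ≈⟨ ΣF-δ n (sh i) (λ l → δR j (iter s l)) ⟩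
    δR j (iter s (sh i)) ∎
    where
    P-row : ∀ l → P n i l P.≡ δR l (sh i)
    P-row l = P.cong (λ b → if b then 1# else 0#) (P-entry i l)
    select : ∀ l → δR l (sh i) * δR j (iter s l) ≈ (if ⌊ l F.≟ sh i ⌋ then δR j (iter s l) else 0#)
    select l with ⌊ l F.≟ sh i ⌋
    ... | true = *-identityˡ _
    ... | false = zeroˡ _

  M : Mat N
  M = ((a₀ · 𝟙) ⊕ (aₜ · matPow (P n) t)) ⊗ J k

  term : Fin N → Fin 2 → Fin N → Carrier
  term r e s = coef e * fromℕ (δ (blk s) (target e (blk r)))

  entry : ∀ r s → M r s ≈ ΣF 2 (λ e → term r e s)
  entry r s = begin
    (a₀ * 𝟙 (blk r) (blk s) + aₜ * matPow (P n) t (blk r) (blk s)) * 1#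
      ≈⟨ *-identityʳ _ ⟩
    a₀ * 𝟙 (blk r) (blk s) + aₜ * matPow (P n) t (blk r) (blk s)
      ≈⟨ +-cong (*-congˡ (trans (matPow-P 0 (blk r) (blk s)) (sym (fromℕ-δ (blk s) (blk r)))))
                (*-congˡ (trans (matPow-P t (blk r) (blk s)) (sym (fromℕ-δ (blk s) (π (blk r)))))) ⟩
    term r zero s + term r (suc zero) s
      ≈⟨ +-congˡ (sym (+-identityʳ _)) ⟩
    ΣF 2 (λ e → term r e s) ∎

  wt : (Fin N → Fin 2) → Carrier
  wt S = ΠF N (coef ∘ S)

  per-as-injections : per M ≈ ΣA N N (λ σ → if injectiveᵇ σ then ΠF N (λ r → M r (σ r)) else 0#)
  per-as-injections = trans (Σl-filter isInjᵇ (allFuns N N) (λ σ → ΠF N (λ r → M r (σ r))))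
    (ΣA-cong N N (λ σ → reflexive (P.cong (λ b → if b then ΠF N (λ r → M r (σ r)) else 0#) (isInjᵇ≡injectiveᵇ σ))))

  expand-row-product : ∀ σ → ΠF N (λ r → M r (σ r)) ≈ ΣA N 2 (λ S → wt S * fromℕ (inBlocks (targets S) σ))
  expand-row-product σ = begin
    ΠF N (λ r → M r (σ r))                      ≈⟨ ΠF-cong N (λ r → entry r (σ r)) ⟩
    ΠF N (λ r → ΣF 2 (λ e → term r e (σ r)))    ≈⟨ prod-of-sums N 2 (λ r e → term r e (σ r)) ⟩
    ΣA N 2 (λ S → ΠF N (λ r → term r (S r) (σ r)))
      ≈⟨ ΣA-cong N 2 (λ S → trans (Πl-* (allFin N) _ _) (*-congˡ (sym (fromℕ-Πl (allFin N) (λ r → δ (blk (σ r)) (targets S r)))))) ⟩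
    ΣA N 2 (λ S → wt S * fromℕ (inBlocks (targets S) σ)) ∎

  per-as-choice-sum : per M ≈ ΣA N 2 (λ S → wt S * fromℕ (blockInjections (targets S)))
  per-as-choice-sum = begin
    per M                                                                          ≈⟨ per-as-injections ⟩
    ΣA N N (λ σ → if injectiveᵇ σ then ΠF N (λ r → M r (σ r)) else 0#)             ≈⟨ ΣA-cong N N expand ⟩
    ΣA N N (λ σ → ΣA N 2 (λ S → wt S * fromℕ (if injectiveᵇ σ then inBlocks (targets S) σ else 0)))
                                                                                   ≈⟨ Σl-swap (allFuns N N) (allFuns N 2) _ ⟩
    ΣA N 2 (λ S → ΣA N N (λ σ → wt S * fromℕ (if injectiveᵇ σ then inBlocks (targets S) σ else 0)))
      ≈⟨ ΣA-cong N 2 (λ S → trans (sym (Σl-*ˡ (allFuns N N) (wt S) _))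
                                  (*-congˡ (sym (fromℕ-Σl (allFuns N N) (λ σ → if injectiveᵇ σ then inBlocks (targets S) σ else 0))))) ⟩
    ΣA N 2 (λ S → wt S * fromℕ (blockInjections (targets S))) ∎
    where
    expand : ∀ σ → (if injectiveᵇ σ then ΠF N (λ r → M r (σ r)) else 0#)
                   ≈ ΣA N 2 (λ S → wt S * fromℕ (if injectiveᵇ σ then inBlocks (targets S) σ else 0))
    expand σ with injectiveᵇ σ
    ... | true = expand-row-product σ
    ... | false = sym (trans (ΣA-cong N 2 (λ S → zeroʳ (wt S))) (Σl-0 (allFuns N 2)))

  g : Fin (ℕ.suc k) → Carrier
  g l = fromℕ (k C toℕ l) * (pow a₀ (k ∸ toℕ l) * pow aₜ (toℕ l))

  open OrbitSum n′ t (ℕ.suc k) g using (invariantᵇ; q; invariant-sum)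

  k!ⁿ : ℕ
  k!ⁿ = (k !) ^ n

  counted : ∀ S → blockInjections (targets S) P.≡ (if invariantᵇ (blockCount S) then k!ⁿ else 0)
  counted S = P.trans (count-block-injections N (targets S)) (choice-count S)

  Φ : (Fin n → ℕ) → Carrier
  Φ w = ΠF n (λ i → pow a₀ (k ∸ w i) * pow aₜ (w i)) * fromℕ (if invariantᵇ w then k!ⁿ else 0)

  Φ-cong : Binomial.RespN R Φ
  Φ-cong e = *-cong (ΠF-cong n (λ i → reflexive (P.cong (λ z → pow a₀ (k ∸ z) * pow aₜ z) (e i))))
    (reflexive (P.cong (λ b → fromℕ (if b then k!ⁿ else 0))
                       (allᵇ-cong n (λ j → P.cong₂ (λ x y → ⌊ x ℕ.≟ y ⌋) (e (ρ j)) (e j)))))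

  per-as-count-sum : per M ≈ ΣA N 2 (λ S → Φ (blockCount S))
  per-as-count-sum = begin
    per M
      ≈⟨ per-as-choice-sum ⟩
    ΣA N 2 (λ S → wt S * fromℕ (blockInjections (targets S)))
      ≈⟨ ΣA-cong N 2 (λ S → *-congˡ (reflexive (P.cong fromℕ (counted S)))) ⟩
    ΣA N 2 (λ S → wt S * fromℕ (if invariantᵇ (blockCount S) then k!ⁿ else 0))
      ≈⟨ ΣA-cong N 2 (λ S → *-congʳ (weight n k S)) ⟩
    ΣA N 2 (λ S → Φ (blockCount S)) ∎

  per-as-invariant-sum : per M ≈ ΣA n (ℕ.suc k) (λ v → if invariantᵇ (toℕ ∘ v) then ΠF n (g ∘ v) else 0#) * fromℕ k!ⁿ
  per-as-invariant-sum = begin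
    per M                                                              ≈⟨ per-as-count-sum ⟩
    ΣA N 2 (λ S → Φ (blockCount S))                                    ≈⟨ sum-by-blockCounts n k Φ Φ-cong ⟩
    ΣA n (ℕ.suc k) (λ v → ΠF n (λ i → fromℕ (k C toℕ (v i))) * Φ (toℕ ∘ v)) ≈⟨ ΣA-cong n (ℕ.suc k) regroup ⟩
    ΣA n (ℕ.suc k) (λ v → (if invariantᵇ (toℕ ∘ v) then ΠF n (g ∘ v) else 0#) * fromℕ k!ⁿ)
                                                                       ≈⟨ sym (Σl-*ʳ (allFuns n (ℕ.suc k)) (fromℕ k!ⁿ) _) ⟩
    ΣA n (ℕ.suc k) (λ v → if invariantᵇ (toℕ ∘ v) then ΠF n (g ∘ v) else 0#) * fromℕ k!ⁿ ∎
    where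
    regroup : ∀ v → ΠF n (λ i → fromℕ (k C toℕ (v i))) * Φ (toℕ ∘ v)
                    ≈ (if invariantᵇ (toℕ ∘ v) then ΠF n (g ∘ v) else 0#) * fromℕ k!ⁿ
    regroup v with invariantᵇ (toℕ ∘ v)
    ... | true = trans (sym (*-assoc _ _ _)) (*-congʳ (sym (Πl-* (allFin n) _ _)))
    ... | false = trans (*-congˡ (zeroʳ _)) (trans (zeroʳ _) (sym (zeroˡ _)))

  -- (5) Evaluating the invariant sum and distributing (k!)ⁿ = ((k!)^q)^d over the d factors.
  per-formula : per M ≈ pow (fromℕ ((k !) ^ q)
                              * ΣF (ℕ.suc k) (λ l → fromℕ ((k C toℕ l) ^ q) * pow (pow a₀ (k ∸ toℕ l) * pow aₜ (toℕ l)) q)) d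
  per-formula = begin
    per M                        ≈⟨ per-as-invariant-sum ⟩
    Inv * fromℕ k!ⁿ              ≈⟨ *-cong invariant-sum k!ⁿ-as-power ⟩
    pow X d * pow Y d            ≈⟨ *-comm _ _ ⟩
    pow Y d * pow X d            ≈⟨ sym (pow-distrib-* Y X d) ⟩
    pow (Y * X) d                ≈⟨ pow-cong d (*-congˡ (ΣF-cong (ℕ.suc k) power-of-term)) ⟩
    pow (Y * ΣF (ℕ.suc k) (λ l → fromℕ ((k C toℕ l) ^ q) * pow (pow a₀ (k ∸ toℕ l) * pow aₜ (toℕ l)) q)) d ∎
    where
    Inv = ΣA n (ℕ.suc k) (λ v → if invariantᵇ (toℕ ∘ v) then ΠF n (g ∘ v) else 0#)
    X = ΣF (ℕ.suc k) (λ l → pow (g l) q)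
    Y = fromℕ ((k !) ^ q)
    power-of-term : ∀ l → pow (g l) q ≈ fromℕ ((k C toℕ l) ^ q) * pow (pow a₀ (k ∸ toℕ l) * pow aₜ (toℕ l)) q
    power-of-term l = trans (pow-distrib-* _ _ q) (*-congʳ (sym (fromℕ-^ _ q)))
    k!ⁿ-as-power : fromℕ k!ⁿ ≈ pow Y d
    k!ⁿ-as-power = begin
      fromℕ ((k !) ^ n)               ≈⟨ fromℕ-^ (k !) n ⟩
      pow (fromℕ (k !)) n             ≡⟨ P.cong (pow (fromℕ (k !))) (P.sym (m/n*n≡m d∣n)) ⟩
      pow (fromℕ (k !)) (q ℕ.* d)     ≈⟨ sym (pow-pow _ q d) ⟩
      pow (pow (fromℕ (k !)) q) d     ≈⟨ pow-cong d (sym (fromℕ-^ (k !) q)) ⟩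
      pow Y d ∎

theorem32 : {c ℓ : Level} (R : CommutativeRing c ℓ) (n t k : ℕ) →
  (hn : 1 ≤ n) → 1 ≤ t → 1 ≤ k →
  (a₀ aₜ : CommutativeRing.Carrier R) →
  let open CommutativeRing R
      open RingDefs R
      d = gcd n t
      q = quot-gcd n t hn
  in per (((a₀ · 𝟙) ⊕ (aₜ · matPow (P n) t)) ⊗ J k)
     ≈ pow (fromℕ ((k !) ^ q)
            * ∑ {suc k} (λ l → fromℕ ((k C toℕ l) ^ q)
                               * pow (pow a₀ (k ∸ toℕ l) * pow aₜ (toℕ l)) q))
           d
theorem32 R (suc n′) t k (s≤s z≤n) _ _ a₀ aₜ = PermanentFormula.per-formula R n′ t k a₀ aₜ
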